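{- If $m$ is a non-negative integer, then \[ \sum_{n=1}^\infty\frac{2^{2n}}{n(n+1)\binom{2(n+m)}{n+m}\binom{n+m}{m}}=\frac{1}{\binom{2m}{m}}\left(\left(m-\frac12\right)\left(4O_m^{(2)}-3\zeta(2)\right)+1\right). \] In particular, \[ \sum_{n=1}^\infty\frac{2^{2n}}{n(n+1)\binom{2n}{n}}=\frac{\pi^2}{4}+1,\quad \sum_{n=1}^\infty\frac{2^{2n}}{n(n+1)^2\binom{2(n+1)}{n+1}}=\frac32-\frac{\pi^2}{8},\quad \sum_{n=1}^\infty\frac{2^{2n}}{n(n+1)^2(n+2)\binom{2(n+2)}{n+2}}=\frac{23}{36}-\frac{\pi^2}{16}. \]
   Context: $\zeta$ is the Riemann zeta function. For nonnegative integer $m$, $O_m^{(2)}=\sum_{j=1}^m (2j-1)^{ -2}$ (empty sum $=0$). -}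

module Defs where

open import Data.Nat as ℕ using (ℕ; zero; suc; _^_)
open import Data.Nat.Combinatorics using (_C_)
open import Data.Integer using (ℤ; +_)
open import Data.Rational using (ℚ; _/_; _+_; _-_; _*_; 0ℚ; 1ℚ)

-- a / d as a rational; the value at d = 0 is irrelevant (never used:
-- all denominators below are positive) and set to 0
_⁄_ : ℤ → ℕ → ℚ
a ⁄ zero = 0ℚ
a ⁄ suc d = a / suc d

Σ₁ : ℕ → (ℕ → ℚ) → ℚ
Σ₁ zero f = 0ℚ
Σ₁ (suc N) f = Σ₁ N f + f (suc N)

term : ℕ → ℕ → ℚ
term m n = (+ (2 ^ (2 ℕ.* n))) ⁄
  (n ℕ.* (n ℕ.+ 1) ℕ.* ((2 ℕ.* (n ℕ.+ m)) C (n ℕ.+ m)) ℕ.* ((n ℕ.+ m) C m))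

lhsPartial : ℕ → ℕ → ℚ
lhsPartial m N = Σ₁ N (term m)

O2 : ℕ → ℚ
O2 m = Σ₁ m (λ j → (+ 1) ⁄ ((2 ℕ.* j ℕ.∸ 1) ℕ.* (2 ℕ.* j ℕ.∸ 1)))

zeta2Partial : ℕ → ℚ
zeta2Partial N = Σ₁ N (λ k → (+ 1) ⁄ (k ℕ.* k))

-- right-hand side with ζ(2) replaced by a rational value z:
-- (1 / C(2m,m)) ((m - 1/2)(4 O_m^{(2)} - 3 z) + 1)
rhsWith : ℕ → ℚ → ℚ
rhsWith m z = ((+ 1) ⁄ ((2 ℕ.* m) C m)) *
  ((((+ m) / 1) - ((+ 1) / 2)) * ((((+ 4) / 1) * O2 m) - (((+ 3) / 1) * z)) + 1ℚ)

-- Write c_j = C(2j, j), t_j(n) for the n-th summand of the series with parameter j, ζ_N for the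
-- N-th partial sum of ζ(2), and
--   E_N(j) = c_j (t_j(1) + ⋯ + t_j(N)) − 1 − (j − ½) (4 O_j − 3 ζ_N),
-- so that the difference of the two sides at stage N is E_N(m) / c_m. The ratios t_j(n+1) / t_j(n)
-- and c_{j+1} t_{j+1}(n) / (c_j t_j(n)) are rational in n and j; this makes the partial sums telescope
-- and gives the recurrence (2j − 1) E_N(j+1) = (2j + 1) E_N(j) + β_N(j), whose boundary term satisfies
-- 0 ≤ β_N(j) ≤ β_N(0) = 2 · 4^(N+1) / ((N+1) C(2N+2, N+1)) = O(N^(−1/2)). Hence q_j = E_N(j) / (2j − 1)
-- moves by at most β_N(0) / 2 as j runs from m up to N, and at the top index
-- q_N = (c_N (t_N(1) + ⋯ + t_N(N)) − 1) / (2N − 1) − 2 (ζ_{2N} − ζ_N) = O(1/N).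
-- So E_N(m) → 0; no value of ζ(2) is needed, the argument running downwards from j = N.

module Submission where

open import Relation.Binary.PropositionalEquality using (_≡_; refl; sym; trans; cong; cong₂; subst; module ≡-Reasoning)

-- Binomial coefficients and the denominators of the series

module Combinatorics where
  open import Data.Nat
  open import Data.Nat.Properties
  open import Data.Nat.Combinatorics using (_C_; nCk+nC[k+1]≡[n+1]C[k+1]; nC1≡n; nCn≡1)
  open import Data.Nat.Tactic.RingSolver using (solve-∀)

  centralBinom : ℕ → ℕ
  centralBinom n = 2 * n C n

  [1+k]*[1+n]C[1+k]≡[1+n]*nCk : ∀ n k → suc k * (suc n C suc k) ≡ suc n * (n C k)
  [1+k]*[1+n]C[1+k]≡[1+n]*nCk zero    zero    = refl
  [1+k]*[1+n]C[1+k]≡[1+n]*nCk zero    (suc k) = *-zeroʳ (2 + k)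
  [1+k]*[1+n]C[1+k]≡[1+n]*nCk (suc n) zero    = trans (*-identityˡ _) (trans (nC1≡n (2 + n)) (sym (*-identityʳ (2 + n))))
  [1+k]*[1+n]C[1+k]≡[1+n]*nCk (suc n) (suc k) = begin
    (2 + k) * ((2 + n) C (2 + k))
      ≡⟨ cong ((2 + k) *_) (nCk+nC[k+1]≡[n+1]C[k+1] (1 + n) (1 + k)) ⟨
    (2 + k) * (X + Y)
      ≡⟨ split X Y k ⟩
    X + ((1 + k) * X + (2 + k) * Y)
      ≡⟨ cong₂ (λ a b → X + (a + b))
           ([1+k]*[1+n]C[1+k]≡[1+n]*nCk n k) ([1+k]*[1+n]C[1+k]≡[1+n]*nCk n (suc k)) ⟩
    X + ((1 + n) * (n C k) + (1 + n) * (n C (1 + k)))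
      ≡⟨ cong (X +_) (*-distribˡ-+ (1 + n) (n C k) (n C (1 + k))) ⟨
    X + (1 + n) * (n C k + n C (1 + k))
      ≡⟨ cong (λ x → X + (1 + n) * x) (nCk+nC[k+1]≡[n+1]C[k+1] n k) ⟩
    (2 + n) * X ∎
    where
    open ≡-Reasoning
    X = (1 + n) C (1 + k)
    Y = (1 + n) C (2 + k)
    split : ∀ x y k → (2 + k) * (x + y) ≡ x + ((1 + k) * x + (2 + k) * y)
    split = solve-∀

  [1+n]*[1+n+k]Ck≡[1+n+k]*[n+k]Ck : ∀ n k → suc n * (suc (n + k) C k) ≡ suc (n + k) * ((n + k) C k)
  [1+n]*[1+n+k]Ck≡[1+n+k]*[n+k]Ck n zero = cong (λ m → suc m * 1) (sym (+-identityʳ n))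
  [1+n]*[1+n+k]Ck≡[1+n+k]*[n+k]Ck n (suc k) = +-cancelʳ-≡ _ _ _ (begin
    suc n * X + suc m * (m C k)  ≡⟨ cong (suc n * X +_) ([1+k]*[1+n]C[1+k]≡[1+n]*nCk m k) ⟨
    suc n * X + suc k * X        ≡⟨ *-distribʳ-+ X (suc n) (suc k) ⟨
    suc m * X                    ≡⟨ cong (suc m *_) (nCk+nC[k+1]≡[n+1]C[k+1] m k) ⟨
    suc m * (m C k + m C suc k)  ≡⟨ *-distribˡ-+ (suc m) (m C k) (m C suc k) ⟩
    suc m * (m C k) + suc m * (m C suc k) ≡⟨ +-comm (suc m * (m C k)) _ ⟩
    suc m * (m C suc k) + suc m * (m C k) ∎)
    where
    open ≡-Reasoning
    m = n + suc k
    X = suc m C suc k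

  centralBinom-suc : ∀ n → suc n * centralBinom (suc n) ≡ 2 * (2 * n + 1) * centralBinom n
  centralBinom-suc n = *-cancelˡ-≡ _ _ (suc n) (begin
    suc n * (suc n * centralBinom (suc n))
      ≡⟨ cong (λ a → suc n * (suc n * (a C suc n))) (2[1+n]≡2+[n+n] n) ⟩
    suc n * (suc n * (suc (suc m) C suc n))
      ≡⟨ cong (suc n *_) ([1+k]*[1+n]C[1+k]≡[1+n]*nCk (suc m) n) ⟩
    suc n * (suc (suc m) * (suc m C n))
      ≡⟨ x*[y*z]≡y*[x*z] (suc n) (suc (suc m)) (suc m C n) ⟩
    suc (suc m) * (suc n * (suc m C n))
      ≡⟨ cong (suc (suc m) *_) ([1+n]*[1+n+k]Ck≡[1+n+k]*[n+k]Ck n n) ⟩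
    suc (suc m) * (suc m * (m C n))
      ≡⟨ regroup n (m C n) ⟩
    suc n * (2 * (2 * n + 1) * (m C n))
      ≡⟨ cong (λ a → suc n * (2 * (2 * n + 1) * (a C n))) (2n≡n+n n) ⟨
    suc n * (2 * (2 * n + 1) * centralBinom n) ∎)
    where
    open ≡-Reasoning
    m = n + n
    2[1+n]≡2+[n+n] : ∀ n → 2 * suc n ≡ suc (suc (n + n))
    2[1+n]≡2+[n+n] = solve-∀
    2n≡n+n : ∀ n → 2 * n ≡ n + n
    2n≡n+n = solve-∀
    x*[y*z]≡y*[x*z] : ∀ x y z → x * (y * z) ≡ y * (x * z)
    x*[y*z]≡y*[x*z] = solve-∀
    regroup : ∀ n c → (2 + (n + n)) * ((1 + (n + n)) * c) ≡ (1 + n) * (2 * (2 * n + 1) * c)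
    regroup = solve-∀

  nCk≢0 : ∀ {n k} → k ≤ n → NonZero (n C k)
  nCk≢0 {n}     {zero}  _         = _
  nCk≢0 {suc n} {suc k} (s≤s k≤n) = m*n≢0⇒n≢0 (suc k)
    {{subst NonZero (sym ([1+k]*[1+n]C[1+k]≡[1+n]*nCk n k)) (m*n≢0 (suc n) (n C k) {{_}} {{nCk≢0 k≤n}})}}

  centralBinom≢0 : ∀ n → NonZero (centralBinom n)
  centralBinom≢0 n = nCk≢0 (m≤n*m n 2)

  2^2[1+n]≡4*2^2n : ∀ n → 2 ^ (2 * suc n) ≡ 4 * 2 ^ (2 * n)
  2^2[1+n]≡4*2^2n n = trans (cong (2 ^_) (*-suc 2 n)) (sym (*-assoc 2 2 (2 ^ (2 * n))))

  -- The inductive step amounts to 4 s (s + 1) ≤ (2 s + 1)².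
  centralBinom-lowerBound : ∀ n → 2 ^ (2 * suc n) * 2 ^ (2 * suc n) ≤ 4 * suc n * (centralBinom (suc n) * centralBinom (suc n))
  centralBinom-lowerBound zero    = ≤-refl
  centralBinom-lowerBound (suc n) = *-cancelʳ-≤ _ _ (suc s * suc s) (begin
    2 ^ (2 * suc s) * 2 ^ (2 * suc s) * (suc s * suc s)
      ≡⟨ cong (λ a → a * a * (suc s * suc s)) (2^2[1+n]≡4*2^2n s) ⟩
    4 * P * (4 * P) * (suc s * suc s)
      ≡⟨ regroup₁ P s ⟩
    16 * (suc s * suc s) * (P * P)
      ≤⟨ *-monoʳ-≤ (16 * (suc s * suc s)) (centralBinom-lowerBound n) ⟩
    16 * (suc s * suc s) * (4 * s * (C * C))
      ≤⟨ m≤m+n _ (16 * suc s * (C * C)) ⟩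
    16 * (suc s * suc s) * (4 * s * (C * C)) + 16 * suc s * (C * C)
      ≡⟨ regroup₂ s C ⟩
    4 * suc s * ((2 * (2 * s + 1) * C) * (2 * (2 * s + 1) * C))
      ≡⟨ cong (λ a → 4 * suc s * (a * a)) (centralBinom-suc s) ⟨
    4 * suc s * ((suc s * C′) * (suc s * C′))
      ≡⟨ regroup₃ s C′ ⟩
    4 * suc s * (C′ * C′) * (suc s * suc s) ∎)
    where
    open ≤-Reasoning
    s = suc n
    P = 2 ^ (2 * s)
    C = centralBinom s
    C′ = centralBinom (suc s)
    regroup₁ : ∀ p s → 4 * p * (4 * p) * ((1 + s) * (1 + s)) ≡ 16 * ((1 + s) * (1 + s)) * (p * p)
    regroup₁ = solve-∀
    regroup₂ : ∀ s c → 16 * ((1 + s) * (1 + s)) * (4 * s * (c * c)) + 16 * (1 + s) * (c * c)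
                     ≡ 4 * (1 + s) * ((2 * (2 * s + 1) * c) * (2 * (2 * s + 1) * c))
    regroup₂ = solve-∀
    regroup₃ : ∀ s c → 4 * (1 + s) * (((1 + s) * c) * ((1 + s) * c)) ≡ 4 * (1 + s) * (c * c) * ((1 + s) * (1 + s))
    regroup₃ = solve-∀

  -- The denominator in Defs.term: term j n is definitionally (+ 2 ^ (2 * n)) ⁄ denom j n.
  denom : ℕ → ℕ → ℕ
  denom j n = n * (n + 1) * (2 * (n + j) C (n + j)) * ((n + j) C j)

  denom≢0 : ∀ j n → NonZero (denom j (suc n))
  denom≢0 j n = m*n≢0 _ _ {{m*n≢0 _ _ {{m*n≢0 (suc n) (suc n + 1) {{_}} {{_}}}}
                                         {{centralBinom≢0 (suc n + j)}}}}
                          {{nCk≢0 (m≤n+m j (suc n))}}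

  denom-zero : ∀ n → denom 0 n ≡ suc n * (n * centralBinom n)
  denom-zero n = begin
    n * (n + 1) * (2 * (n + 0) C (n + 0)) * ((n + 0) C 0) ≡⟨ cong (λ k → n * (n + 1) * (2 * k C k) * (k C 0)) (+-identityʳ n) ⟩
    n * (n + 1) * centralBinom n * 1                     ≡⟨ regroup n (centralBinom n) ⟩
    suc n * (n * centralBinom n) ∎
    where
    open ≡-Reasoning
    regroup : ∀ n c → n * (n + 1) * c * 1 ≡ (1 + n) * (n * c)
    regroup = solve-∀

  denom-one : ∀ j → denom j 1 ≡ 4 * (2 * j + 1) * centralBinom j
  denom-one j = begin
    denom j 1                              ≡⟨ cong (2 * centralBinom (suc j) *_) [1+j]Cj≡1+j ⟩
    2 * centralBinom (suc j) * suc j       ≡⟨ *-assoc 2 (centralBinom (suc j)) (suc j) ⟩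
    2 * (centralBinom (suc j) * suc j)     ≡⟨ cong (2 *_) (*-comm (centralBinom (suc j)) (suc j)) ⟩
    2 * (suc j * centralBinom (suc j))     ≡⟨ cong (2 *_) (centralBinom-suc j) ⟩
    2 * (2 * (2 * j + 1) * centralBinom j) ≡⟨ regroup j (centralBinom j) ⟩
    4 * (2 * j + 1) * centralBinom j ∎
    where
    open ≡-Reasoning
    [1+j]Cj≡1+j : suc j C j ≡ suc j
    [1+j]Cj≡1+j = begin
      suc j C j             ≡⟨ *-identityˡ (suc j C j) ⟨
      1 * (suc j C j)       ≡⟨ [1+n]*[1+n+k]Ck≡[1+n+k]*[n+k]Ck 0 j ⟩
      suc j * (j C j)       ≡⟨ cong (suc j *_) (nCn≡1 j) ⟩
      suc j * 1             ≡⟨ *-identityʳ (suc j) ⟩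
      suc j ∎
    regroup : ∀ j c → 2 * (2 * (2 * j + 1) * c) ≡ 4 * (2 * j + 1) * c
    regroup = solve-∀

  denom-suc-n : ∀ j n → n * (n + 1) * denom j (suc n) ≡ 2 * (n + 2) * (2 * (n + j) + 1) * denom j n
  denom-suc-n j n = begin
    n * (n + 1) * denom j (suc n)
      ≡⟨ regroup₁ n (centralBinom (suc k)) (suc k C j) ⟩
    n * (n + 1) * (n + 2) * centralBinom (suc k) * (suc n * (suc k C j))
      ≡⟨ cong (n * (n + 1) * (n + 2) * centralBinom (suc k) *_) ([1+n]*[1+n+k]Ck≡[1+n+k]*[n+k]Ck n j) ⟩
    n * (n + 1) * (n + 2) * centralBinom (suc k) * (suc k * (k C j))
      ≡⟨ regroup₂ (n * (n + 1) * (n + 2)) (centralBinom (suc k)) k (k C j) ⟩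
    n * (n + 1) * (n + 2) * (k C j) * (suc k * centralBinom (suc k))
      ≡⟨ cong (n * (n + 1) * (n + 2) * (k C j) *_) (centralBinom-suc k) ⟩
    n * (n + 1) * (n + 2) * (k C j) * (2 * (2 * k + 1) * centralBinom k)
      ≡⟨ regroup₃ n k (k C j) (centralBinom k) ⟩
    2 * (n + 2) * (2 * k + 1) * denom j n ∎
    where
    open ≡-Reasoning
    k = n + j
    regroup₁ : ∀ n a b → n * (n + 1) * ((1 + n) * (1 + n + 1) * a * b) ≡ n * (n + 1) * (n + 2) * a * ((1 + n) * b)
    regroup₁ = solve-∀
    regroup₂ : ∀ x a k b → x * a * ((1 + k) * b) ≡ x * b * ((1 + k) * a)
    regroup₂ = solve-∀
    regroup₃ : ∀ n k b c → n * (n + 1) * (n + 2) * b * (2 * (2 * k + 1) * c) ≡ 2 * (n + 2) * (2 * k + 1) * (n * (n + 1) * c * b)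
    regroup₃ = solve-∀

  denom-suc-j : ∀ j n → suc j * denom (suc j) n ≡ 2 * (2 * (n + j) + 1) * denom j n
  denom-suc-j j n = begin
    suc j * denom (suc j) n
      ≡⟨ cong (λ a → suc j * (n * (n + 1) * centralBinom a * (a C suc j))) (+-suc n j) ⟩
    suc j * (n * (n + 1) * centralBinom (suc k) * (suc k C suc j))
      ≡⟨ x*[y*z]≡y*[x*z] (suc j) (n * (n + 1) * centralBinom (suc k)) (suc k C suc j) ⟩
    n * (n + 1) * centralBinom (suc k) * (suc j * (suc k C suc j))
      ≡⟨ cong (n * (n + 1) * centralBinom (suc k) *_) ([1+k]*[1+n]C[1+k]≡[1+n]*nCk k j) ⟩
    n * (n + 1) * centralBinom (suc k) * (suc k * (k C j))
      ≡⟨ regroup₂ (n * (n + 1)) (centralBinom (suc k)) k (k C j) ⟩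
    n * (n + 1) * (k C j) * (suc k * centralBinom (suc k))
      ≡⟨ cong (n * (n + 1) * (k C j) *_) (centralBinom-suc k) ⟩
    n * (n + 1) * (k C j) * (2 * (2 * k + 1) * centralBinom k)
      ≡⟨ regroup₃ (n * (n + 1)) k (k C j) (centralBinom k) ⟩
    2 * (2 * k + 1) * denom j n ∎
    where
    open ≡-Reasoning
    k = n + j
    x*[y*z]≡y*[x*z] : ∀ x y z → x * (y * z) ≡ y * (x * z)
    x*[y*z]≡y*[x*z] = solve-∀
    regroup₂ : ∀ x a k b → x * a * ((1 + k) * b) ≡ x * b * ((1 + k) * a)
    regroup₂ = solve-∀
    regroup₃ : ∀ x k b c → x * b * (2 * (2 * k + 1) * c) ≡ 2 * (2 * k + 1) * (x * c * b)
    regroup₃ = solve-∀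

  -- Cross-multiplied forms of t_j(m+1) / t_j(m) = 2m(m+1) / ((m+2)(2(m+j)+1)),
  -- c_{j+1} t_{j+1}(n) / (c_j t_j(n)) = (2j+1) / (2(n+j)+1) and c_j t_j(1) = 1 / (2j+1).
  term-cross-n : ∀ j m → 2 ^ (2 * suc m) * ((m + 2) * (2 * (m + j) + 1)) * denom j m
                       ≡ 2 ^ (2 * m) * (2 * m * (m + 1)) * denom j (suc m)
  term-cross-n j m = begin
    2 ^ (2 * suc m) * ((m + 2) * (2 * k + 1)) * denom j m
      ≡⟨ cong (λ p → p * ((m + 2) * (2 * k + 1)) * denom j m) (2^2[1+n]≡4*2^2n m) ⟩
    4 * P * ((m + 2) * (2 * k + 1)) * denom j m
      ≡⟨ regroup₁ P m k (denom j m) ⟩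
    P * 2 * (2 * (m + 2) * (2 * k + 1) * denom j m)
      ≡⟨ cong (P * 2 *_) (denom-suc-n j m) ⟨
    P * 2 * (m * (m + 1) * denom j (suc m))
      ≡⟨ regroup₂ P m (denom j (suc m)) ⟩
    P * (2 * m * (m + 1)) * denom j (suc m) ∎
    where
    open ≡-Reasoning
    k = m + j
    P = 2 ^ (2 * m)
    regroup₁ : ∀ p m k d → 4 * p * ((m + 2) * (2 * k + 1)) * d ≡ p * 2 * (2 * (m + 2) * (2 * k + 1) * d)
    regroup₁ = solve-∀
    regroup₂ : ∀ p m d → p * 2 * (m * (m + 1) * d) ≡ p * (2 * m * (m + 1)) * d
    regroup₂ = solve-∀

  term-cross-j : ∀ j n → 2 ^ (2 * n) * (centralBinom (suc j) * (2 * (n + j) + 1)) * denom j n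
                       ≡ 2 ^ (2 * n) * ((2 * j + 1) * centralBinom j) * denom (suc j) n
  term-cross-j j n = *-cancelʳ-≡ _ _ (suc j) (begin
    P * (C′ * (2 * k + 1)) * denom j n * suc j
      ≡⟨ regroup₁ P C′ k (denom j n) j ⟩
    P * (2 * k + 1) * denom j n * (suc j * C′)
      ≡⟨ cong (P * (2 * k + 1) * denom j n *_) (centralBinom-suc j) ⟩
    P * (2 * k + 1) * denom j n * (2 * (2 * j + 1) * C)
      ≡⟨ regroup₂ P k (denom j n) j C ⟩
    P * ((2 * j + 1) * C) * (2 * (2 * k + 1) * denom j n)
      ≡⟨ cong (P * ((2 * j + 1) * C) *_) (denom-suc-j j n) ⟨
    P * ((2 * j + 1) * C) * (suc j * denom (suc j) n)
      ≡⟨ regroup₃ P ((2 * j + 1) * C) j (denom (suc j) n) ⟩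
    P * ((2 * j + 1) * C) * denom (suc j) n * suc j ∎)
    where
    open ≡-Reasoning
    k = n + j
    P = 2 ^ (2 * n)
    C = centralBinom j
    C′ = centralBinom (suc j)
    regroup₁ : ∀ p c k d j → p * (c * (2 * k + 1)) * d * (1 + j) ≡ p * (2 * k + 1) * d * ((1 + j) * c)
    regroup₁ = solve-∀
    regroup₂ : ∀ p k d j c → p * (2 * k + 1) * d * (2 * (2 * j + 1) * c) ≡ p * ((2 * j + 1) * c) * (2 * (2 * k + 1) * d)
    regroup₂ = solve-∀
    regroup₃ : ∀ p x j d → p * x * ((1 + j) * d) ≡ p * x * d * (1 + j)
    regroup₃ = solve-∀

  term-cross-one : ∀ j → 2 ^ 2 * ((2 * j + 1) * centralBinom j) * 1 ≡ 1 * 1 * denom j 1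
  term-cross-one j = trans (regroup j (centralBinom j)) (sym (trans (*-identityˡ (denom j 1)) (denom-one j)))
    where
    regroup : ∀ j c → 2 ^ 2 * ((2 * j + 1) * c) * 1 ≡ 4 * (2 * j + 1) * c
    regroup = solve-∀

  2m[m+1]≤[m+2][2[m+j]+1] : ∀ m j → 2 * m * (m + 1) ≤ (m + 2) * (2 * (m + j) + 1)
  2m[m+1]≤[m+2][2[m+j]+1] m j = subst (2 * m * (m + 1) ≤_) (sym (split m j)) (m≤m+n _ _)
    where
    split : ∀ m j → (m + 2) * (2 * (m + j) + 1) ≡ 2 * m * (m + 1) + (2 * m * j + 3 * m + 4 * j + 2)
    split = solve-∀

  2n+1≢0 : ∀ n → NonZero (2 * n + 1)
  2n+1≢0 n = ≢-nonZero (m+1+n≢0 (2 * n) {0})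

open Combinatorics

open import Level using (0ℓ)
open import Data.Nat as ℕ using (ℕ; zero; suc; z≤n; s≤s; _≥_)
import Data.Nat.Properties as ℕ
open import Data.Integer as ℤ using (+_)
import Data.Integer.Properties as ℤ
open import Data.Integer.Tactic.RingSolver as ℤ-Solver using ()
import Data.Nat.Tactic.RingSolver as ℕ-Solver
open import Data.Rational hiding (_≥_)
open import Data.Rational.Properties
import Data.Rational.Unnormalised as ℚᵘ
import Data.Rational.Unnormalised.Properties as ℚᵘ
open import Relation.Nullary.Decidable using (dec⇒maybe)
open import Data.Sum using (inj₁; inj₂)
open import Data.Product using (∃-syntax; _,_; map₂)
open import Data.Empty using (⊥-elim)
open import Relation.Nullary using (yes; no)
open import Tactic.RingSolver using (solve-∀)
open import Tactic.RingSolver.Core.AlmostCommutativeRing using (AlmostCommutativeRing; fromCommutativeRing)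
open import Defs


-- Rational arithmetic

-- The exact zero test lets the reflective solver discard cancelled monomials.
ℚ-ring : AlmostCommutativeRing 0ℓ 0ℓ
ℚ-ring = fromCommutativeRing +-*-commutativeRing (λ x → dec⇒maybe (0ℚ ≟ x))

ι : ℕ → ℚ
ι n = + n / 1

toℚᵘ-ι : ∀ n → toℚᵘ (ι n) ℚᵘ.≃ ℚᵘ.mkℚᵘ (+ n) 0
toℚᵘ-ι n = toℚᵘ-fromℚᵘ (ℚᵘ.mkℚᵘ (+ n) 0)

ι-homo-+ : ∀ m n → ι (m ℕ.+ n) ≡ ι m + ι n
ι-homo-+ m n = toℚᵘ-injective (begin
  toℚᵘ (ι (m ℕ.+ n))                                   ≈⟨ toℚᵘ-ι (m ℕ.+ n) ⟩
  ℚᵘ.mkℚᵘ (+ (m ℕ.+ n)) 0                               ≈⟨ ℚᵘ.*≡* (cross (+ m) (+ n)) ⟩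
  ℚᵘ.mkℚᵘ (+ m) 0 ℚᵘ.+ ℚᵘ.mkℚᵘ (+ n) 0                  ≈⟨ ℚᵘ.+-cong (toℚᵘ-ι m) (toℚᵘ-ι n) ⟨
  toℚᵘ (ι m) ℚᵘ.+ toℚᵘ (ι n)                           ≈⟨ toℚᵘ-homo-+ (ι m) (ι n) ⟨
  toℚᵘ (ι m + ι n) ∎)
  where
  open ℚᵘ.≃-Reasoning
  cross : ∀ x y → (x ℤ.+ y) ℤ.* (+ 1 ℤ.* + 1) ≡ (x ℤ.* + 1 ℤ.+ y ℤ.* + 1) ℤ.* + 1
  cross = ℤ-Solver.solve-∀

ι-homo-* : ∀ m n → ι (m ℕ.* n) ≡ ι m * ι n
ι-homo-* m n = toℚᵘ-injective (begin
  toℚᵘ (ι (m ℕ.* n))                                   ≈⟨ toℚᵘ-ι (m ℕ.* n) ⟩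
  ℚᵘ.mkℚᵘ (+ (m ℕ.* n)) 0
    ≈⟨ ℚᵘ.*≡* (trans (cong (ℤ._* (+ 1 ℤ.* + 1)) (ℤ.pos-* m n)) (cross (+ m) (+ n))) ⟩
  ℚᵘ.mkℚᵘ (+ m) 0 ℚᵘ.* ℚᵘ.mkℚᵘ (+ n) 0                  ≈⟨ ℚᵘ.*-cong (toℚᵘ-ι m) (toℚᵘ-ι n) ⟨
  toℚᵘ (ι m) ℚᵘ.* toℚᵘ (ι n)                           ≈⟨ toℚᵘ-homo-* (ι m) (ι n) ⟨
  toℚᵘ (ι m * ι n) ∎)
  where
  open ℚᵘ.≃-Reasoning
  cross : ∀ x y → (x ℤ.* y) ℤ.* (+ 1 ℤ.* + 1) ≡ (x ℤ.* y) ℤ.* + 1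
  cross = ℤ-Solver.solve-∀

ι-suc : ∀ n → ι (suc n) ≡ ι n + 1ℚ
ι-suc n = trans (ι-homo-+ 1 n) (+-comm 1ℚ (ι n))

0≤ι : ∀ n → 0ℚ ≤ ι n
0≤ι n = nonNegative⁻¹ (ι n) {{normalize-nonNeg n 1}}

0≤ι+1 : ∀ n → 0ℚ ≤ ι n + 1ℚ
0≤ι+1 n = subst (0ℚ ≤_) (ι-suc n) (0≤ι (suc n))

ι-mono-≤ : ∀ {m n} → m ℕ.≤ n → ι m ≤ ι n
ι-mono-≤ {m} {n} m≤n = begin
  ι m                    ≡⟨ +-identityʳ (ι m) ⟨
  ι m + 0ℚ               ≤⟨ +-monoʳ-≤ (ι m) (0≤ι (n ℕ.∸ m)) ⟩
  ι m + ι (n ℕ.∸ m)      ≡⟨ ι-homo-+ m (n ℕ.∸ m) ⟨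
  ι (m ℕ.+ (n ℕ.∸ m))    ≡⟨ cong ι (ℕ.m+[n∸m]≡n m≤n) ⟩
  ι n ∎
  where open ≤-Reasoning

ι-pos : ∀ n .{{_ : ℕ.NonZero n}} → Positive (ι n)
ι-pos n = normalize-pos n 1

ι-2n+1 : ∀ n → ι (2 ℕ.* n ℕ.+ 1) ≡ ι 2 * ι n + 1ℚ
ι-2n+1 n = trans (ι-homo-+ (2 ℕ.* n) 1) (cong (_+ 1ℚ) (ι-homo-* 2 n))

ι-2[m+n]+1 : ∀ m n → ι (2 ℕ.* (m ℕ.+ n) ℕ.+ 1) ≡ ι 2 * (ι m + ι n) + 1ℚ
ι-2[m+n]+1 m n = trans (ι-2n+1 (m ℕ.+ n)) (cong (λ x → ι 2 * x + 1ℚ) (ι-homo-+ m n))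

ι-1+2j : ∀ j → ι (suc (2 ℕ.* j)) ≡ ι 2 * ι j + 1ℚ
ι-1+2j j = trans (ι-suc (2 ℕ.* j)) (cong (_+ 1ℚ) (ι-homo-* 2 j))

odd-pos : ∀ n → Positive (ι 2 * ι n + 1ℚ)
odd-pos n = subst Positive (ι-1+2j n) (ι-pos (suc (2 ℕ.* n)))

oddSum-pos : ∀ m n → Positive (ι 2 * (ι m + ι n) + 1ℚ)
oddSum-pos m n = subst Positive (ι-2[m+n]+1 m n) (ι-pos (2 ℕ.* (m ℕ.+ n) ℕ.+ 1) {{2n+1≢0 (m ℕ.+ n)}})

*-cancelʳ-≡-pos : ∀ {p q} r .{{_ : Positive r}} → p * r ≡ q * r → p ≡ q
*-cancelʳ-≡-pos r eq = ≤-antisym (*-cancelʳ-≤-pos r (≤-reflexive eq)) (*-cancelʳ-≤-pos r (≤-reflexive (sym eq)))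

a⁄d*d≡a : ∀ a d .{{_ : ℕ.NonZero d}} → ((+ a) ⁄ d) * ι d ≡ ι a
a⁄d*d≡a a (suc d) = toℚᵘ-injective (begin
  toℚᵘ (+ a / suc d * ι (suc d))                 ≈⟨ toℚᵘ-homo-* (+ a / suc d) (ι (suc d)) ⟩
  toℚᵘ (+ a / suc d) ℚᵘ.* toℚᵘ (ι (suc d))       ≈⟨ ℚᵘ.*-cong (toℚᵘ-fromℚᵘ (ℚᵘ.mkℚᵘ (+ a) d)) (toℚᵘ-ι (suc d)) ⟩
  ℚᵘ.mkℚᵘ (+ a) d ℚᵘ.* ℚᵘ.mkℚᵘ (+ suc d) 0       ≈⟨ ℚᵘ.*≡* (cross (+ a) (+ suc d)) ⟩
  ℚᵘ.mkℚᵘ (+ a) 0                                ≈⟨ toℚᵘ-ι a ⟨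
  toℚᵘ (ι a) ∎)
  where
  open ℚᵘ.≃-Reasoning
  cross : ∀ x y → (x ℤ.* y) ℤ.* + 1 ≡ x ℤ.* (y ℤ.* + 1)
  cross = ℤ-Solver.solve-∀

0≤a⁄d : ∀ a d → 0ℚ ≤ (+ a) ⁄ d
0≤a⁄d a zero    = ≤-refl
0≤a⁄d a (suc d) = nonNegative⁻¹ _ {{normalize-nonNeg a (suc d)}}

⁄-cross : ∀ a b x y d e .{{_ : ℕ.NonZero d}} .{{_ : ℕ.NonZero e}} →
          a ℕ.* x ℕ.* e ≡ b ℕ.* y ℕ.* d → ((+ a) ⁄ d) * ι x ≡ ((+ b) ⁄ e) * ι y
⁄-cross a b x y d e eq = *-cancelʳ-≡-pos (ι d * ι e) {{pos*pos⇒pos (ι d) {{ι-pos d}} (ι e) {{ι-pos e}}}} (begin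
  p * ι x * (ι d * ι e)      ≡⟨ regroup p (ι x) (ι d) (ι e) ⟩
  p * ι d * ι x * ι e        ≡⟨ cong (λ z → z * ι x * ι e) (a⁄d*d≡a a d) ⟩
  ι a * ι x * ι e            ≡⟨ ι³ a x e ⟨
  ι (a ℕ.* x ℕ.* e)          ≡⟨ cong ι eq ⟩
  ι (b ℕ.* y ℕ.* d)          ≡⟨ ι³ b y d ⟩
  ι b * ι y * ι d            ≡⟨ cong (λ z → z * ι y * ι d) (a⁄d*d≡a b e) ⟨
  q * ι e * ι y * ι d        ≡⟨ regroup′ q (ι y) (ι d) (ι e) ⟩
  q * ι y * (ι d * ι e) ∎)
  where
  open ≡-Reasoning
  p = (+ a) ⁄ d
  q = (+ b) ⁄ e
  ι³ : ∀ u v w → ι (u ℕ.* v ℕ.* w) ≡ ι u * ι v * ι w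
  ι³ u v w = trans (ι-homo-* (u ℕ.* v) w) (cong (_* ι w) (ι-homo-* u v))
  regroup : ∀ p x d e → p * x * (d * e) ≡ p * d * x * e
  regroup = solve-∀ ℚ-ring
  regroup′ : ∀ q y d e → q * e * y * d ≡ q * y * (d * e)
  regroup′ = solve-∀ ℚ-ring

0≤p*q : ∀ {p q} → 0ℚ ≤ p → 0ℚ ≤ q → 0ℚ ≤ p * q
0≤p*q {p} {q} 0≤p 0≤q = nonNegative⁻¹ (p * q) {{nonNeg*nonNeg⇒nonNeg p {{nonNegative 0≤p}} q {{nonNegative 0≤q}}}}

*-monoʳ-≤-0≤ : ∀ {a b} c → 0ℚ ≤ c → a ≤ b → a * c ≤ b * c
*-monoʳ-≤-0≤ c 0≤c = *-monoʳ-≤-nonNeg c {{nonNegative 0≤c}}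

*-monoˡ-≤-0≤ : ∀ {a b} c → 0ℚ ≤ c → a ≤ b → c * a ≤ c * b
*-monoˡ-≤-0≤ c 0≤c = *-monoˡ-≤-nonNeg c {{nonNegative 0≤c}}

*-mono-≤-0≤ : ∀ {a b c d} → 0ℚ ≤ a → 0ℚ ≤ c → a ≤ b → c ≤ d → a * c ≤ b * d
*-mono-≤-0≤ {a} {b} {c} {d} 0≤a 0≤c a≤b c≤d =
  ≤-trans (*-monoʳ-≤-0≤ c 0≤c a≤b) (*-monoˡ-≤-0≤ b (≤-trans 0≤a a≤b) c≤d)

p≤p+q : ∀ p {q} → 0ℚ ≤ q → p ≤ p + q
p≤p+q p {q} 0≤q = subst (_≤ p + q) (+-identityʳ p) (+-monoʳ-≤ p 0≤q)

≤-by-slack : ∀ {x y} d → y ≡ x + d → 0ℚ ≤ d → x ≤ y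
≤-by-slack {x} d y≡x+d 0≤d = subst (x ≤_) (sym y≡x+d) (p≤p+q x 0≤d)

p-q≤p : ∀ p {q} → 0ℚ ≤ q → p - q ≤ p
p-q≤p p {q} 0≤q = subst (p - q ≤_) (+-identityʳ p) (+-monoʳ-≤ p (neg-antimono-≤ 0≤q))

∣p∣≤∣q∣+∣q-p∣ : ∀ p q → ∣ p ∣ ≤ ∣ q ∣ + ∣ q - p ∣
∣p∣≤∣q∣+∣q-p∣ p q = subst (λ x → ∣ x ∣ ≤ ∣ q ∣ + ∣ q - p ∣) (rearrange p q) (∣p-q∣≤∣p∣+∣q∣ q (q - p))
  where
  rearrange : ∀ p q → q - (q - p) ≡ p
  rearrange = solve-∀ ℚ-ring

∣p-1∣≤1 : ∀ {p} → 0ℚ ≤ p → p ≤ 1ℚ → ∣ p - 1ℚ ∣ ≤ 1ℚ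
∣p-1∣≤1 {p} 0≤p p≤1 with ∣p∣≡p∨∣p∣≡-p (p - 1ℚ)
... | inj₁ ∣p-1∣≡p-1    = subst (_≤ 1ℚ) (sym ∣p-1∣≡p-1) (≤-trans (p-q≤p p (0≤ι 1)) p≤1)
... | inj₂ ∣p-1∣≡-[p-1] = subst (_≤ 1ℚ) (sym (trans ∣p-1∣≡-[p-1] (negate p))) (p-q≤p 1ℚ 0≤p)
  where
  negate : ∀ p → - (p - 1ℚ) ≡ 1ℚ - p
  negate = solve-∀ ℚ-ring

*-ratio⇒≤ : ∀ {p q x y} → Positive x → 0ℚ ≤ q → y ≤ x → p * x ≡ q * y → p ≤ q
*-ratio⇒≤ {p} {q} {x} {y} x-pos 0≤q y≤x eq = *-cancelʳ-≤-pos x {{x-pos}} (begin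
  p * x ≡⟨ eq ⟩
  q * y ≤⟨ *-monoˡ-≤-0≤ q 0≤q y≤x ⟩
  q * x ∎)
  where open ≤-Reasoning

⁄-antitone : ∀ a {d e} .{{_ : ℕ.NonZero d}} .{{_ : ℕ.NonZero e}} → d ℕ.≤ e → (+ a) ⁄ e ≤ (+ a) ⁄ d
⁄-antitone a {d} {e} d≤e = *-ratio⇒≤ (ι-pos e) (0≤a⁄d a d) (ι-mono-≤ d≤e) (trans (a⁄d*d≡a a e) (sym (a⁄d*d≡a a d)))

telescoping-≤ : ∀ (a b : ℕ → ℚ) → (∀ i → ∣ a (suc i) - a i ∣ ≤ b i - b (suc i)) →
                ∀ i d → ∣ a (d ℕ.+ i) - a i ∣ ≤ b i - b (d ℕ.+ i)
telescoping-≤ a b step i zero    = ≤-reflexive (trans (cong ∣_∣ (+-inverseʳ (a i))) (sym (+-inverseʳ (b i))))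
telescoping-≤ a b step i (suc d) = begin
  ∣ a (suc k) - a i ∣                          ≡⟨ cong ∣_∣ (split (a i) (a k) (a (suc k))) ⟩
  ∣ (a (suc k) - a k) + (a k - a i) ∣          ≤⟨ ∣p+q∣≤∣p∣+∣q∣ (a (suc k) - a k) (a k - a i) ⟩
  ∣ a (suc k) - a k ∣ + ∣ a k - a i ∣          ≤⟨ +-mono-≤ (step k) (telescoping-≤ a b step i d) ⟩
  (b k - b (suc k)) + (b i - b k)              ≡⟨ join (b i) (b k) (b (suc k)) ⟩
  b i - b (suc k) ∎
  where
  open ≤-Reasoning
  k = d ℕ.+ i
  split : ∀ x y z → z - x ≡ (z - y) + (y - x)
  split = solve-∀ ℚ-ring
  join : ∀ x y z → (y - z) + (x - y) ≡ x - z
  join = solve-∀ ℚ-ring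

Σ₁-cong : ∀ N {f g : ℕ → ℚ} → (∀ n → f (suc n) ≡ g (suc n)) → Σ₁ N f ≡ Σ₁ N g
Σ₁-cong zero    eq = refl
Σ₁-cong (suc N) eq = cong₂ _+_ (Σ₁-cong N eq) (eq N)

Σ₁-*ˡ : ∀ N a f → Σ₁ N (λ n → a * f n) ≡ a * Σ₁ N f
Σ₁-*ˡ zero    a f = sym (*-zeroʳ a)
Σ₁-*ˡ (suc N) a f = trans (cong (_+ a * f (suc N)) (Σ₁-*ˡ N a f)) (sym (*-distribˡ-+ a (Σ₁ N f) (f (suc N))))

Σ₁-lincomb : ∀ N a b f g → Σ₁ N (λ n → a * f n - b * g n) ≡ a * Σ₁ N f - b * Σ₁ N g
Σ₁-lincomb zero    a b f g = base a b
  where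
  base : ∀ a b → 0ℚ ≡ a * 0ℚ - b * 0ℚ
  base = solve-∀ ℚ-ring
Σ₁-lincomb (suc N) a b f g = trans (cong (_+ (a * f (suc N) - b * g (suc N))) (Σ₁-lincomb N a b f g))
                                   (step a b (Σ₁ N f) (Σ₁ N g) (f (suc N)) (g (suc N)))
  where
  step : ∀ a b F G x y → a * F - b * G + (a * x - b * y) ≡ a * (F + x) - b * (G + y)
  step = solve-∀ ℚ-ring

Σ₁-telescope : ∀ N (h : ℕ → ℚ) → Σ₁ N (λ n → h (suc n) - h n) ≡ h (suc N) - h 1
Σ₁-telescope zero    h = sym (+-inverseʳ (h 1))
Σ₁-telescope (suc N) h = trans (cong (_+ (h (2 ℕ.+ N) - h (suc N))) (Σ₁-telescope N h)) (step (h 1) (h (suc N)) (h (2 ℕ.+ N)))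
  where
  step : ∀ a b c → b - a + (c - b) ≡ c - a
  step = solve-∀ ℚ-ring

-- Null sequences

Null : (ℕ → ℚ) → Set
Null a = ∀ ε → Positive ε → ∃[ N₀ ] (∀ N → N ≥ N₀ → ∣ a N ∣ < ε)

null-≡ : ∀ {a b} → (∀ N → a N ≡ b N) → Null a → Null b
null-≡ a≡b null-a ε ε>0 with null-a ε ε>0
... | N₀ , small = N₀ , λ N N≥N₀ → subst (λ x → ∣ x ∣ < ε) (a≡b N) (small N N≥N₀)

null-≤ : ∀ {a b} K → (∀ N → N ≥ K → ∣ a N ∣ ≤ b N) → Null b → Null a
null-≤ {a} {b} K a≤b null-b ε ε>0 with null-b ε ε>0
... | N₀ , small = K ℕ.⊔ N₀ , λ N N≥ →
  ≤-<-trans (a≤b N (K≤ N≥)) (subst (_< ε) (0≤p⇒∣p∣≡p (0≤b N N≥)) (small N (N₀≤ N≥)))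
  where
  K≤ : ∀ {N} → N ≥ K ℕ.⊔ N₀ → N ≥ K
  K≤ = ℕ.≤-trans (ℕ.m≤m⊔n K N₀)
  N₀≤ : ∀ {N} → N ≥ K ℕ.⊔ N₀ → N ≥ N₀
  N₀≤ = ℕ.≤-trans (ℕ.m≤n⊔m K N₀)
  0≤b : ∀ N → N ≥ K ℕ.⊔ N₀ → 0ℚ ≤ b N
  0≤b N N≥ = ≤-trans (0≤∣p∣ (a N)) (a≤b N (K≤ N≥))

null-∣∣ : ∀ {a} → Null a → Null (λ N → ∣ a N ∣)
null-∣∣ {a} null-a ε ε>0 = map₂ (λ small N N≥N₀ → subst (_< ε) (sym (∣∣p∣∣≡∣p∣ (a N))) (small N N≥N₀)) (null-a ε ε>0)

null-+ : ∀ {a b} → Null a → Null b → Null (λ N → a N + b N)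
null-+ {a} {b} null-a null-b ε ε>0 with null-a (½ * ε) (pos*pos⇒pos ½ ε {{ε>0}}) | null-b (½ * ε) (pos*pos⇒pos ½ ε {{ε>0}})
... | N₁ , small-a | N₂ , small-b = N₁ ℕ.⊔ N₂ , λ N N≥ → begin-strict
  ∣ a N + b N ∣      ≤⟨ ∣p+q∣≤∣p∣+∣q∣ (a N) (b N) ⟩
  ∣ a N ∣ + ∣ b N ∣  <⟨ +-mono-< (small-a N (ℕ.≤-trans (ℕ.m≤m⊔n N₁ N₂) N≥))
                                (small-b N (ℕ.≤-trans (ℕ.m≤n⊔m N₁ N₂) N≥)) ⟩
  ½ * ε + ½ * ε      ≡⟨ halves ε ⟩
  ε ∎
  where
  open ≤-Reasoning
  halves : ∀ e → ½ * e + ½ * e ≡ e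
  halves = solve-∀ ℚ-ring

null-*ˡ : ∀ {a} c → Null a → Null (λ N → c * a N)
null-*ˡ {a} c null-a ε ε>0 = map₂ (λ small N N≥N₀ → scaled (small N N≥N₀)) (null-a δ δ>0)
  where
  open ≤-Reasoning
  k = ∣ c ∣ + 1ℚ
  k>0 : Positive k
  k>0 = nonNeg+pos⇒pos ∣ c ∣ {{nonNegative (0≤∣p∣ c)}} 1ℚ
  instance
    k≢0 : NonZero k
    k≢0 = pos⇒nonZero k {{k>0}}
  δ = ε * 1/ k
  δ>0 : Positive δ
  δ>0 = pos*pos⇒pos ε {{ε>0}} (1/ k) {{1/pos⇒pos k {{k>0}}}}
  regroup : ∀ k e i → k * (e * i) ≡ e * (k * i)
  regroup = solve-∀ ℚ-ring
  scaled : ∀ {x} → ∣ x ∣ < δ → ∣ c * x ∣ < ε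
  scaled {x} ∣x∣<δ = begin-strict
    ∣ c * x ∣          ≡⟨ ∣p*q∣≡∣p∣*∣q∣ c x ⟩
    ∣ c ∣ * ∣ x ∣      ≤⟨ *-monoʳ-≤-0≤ ∣ x ∣ (0≤∣p∣ x) (p≤p+q ∣ c ∣ (0≤ι 1)) ⟩
    k * ∣ x ∣          <⟨ *-monoʳ-<-pos k {{k>0}} ∣x∣<δ ⟩
    k * (ε * 1/ k)     ≡⟨ regroup k ε (1/ k) ⟩
    ε * (k * 1/ k)     ≡⟨ cong (ε *_) (*-inverseʳ k) ⟩
    ε * 1ℚ             ≡⟨ *-identityʳ ε ⟩
    ε ∎

archimedean : ∀ C ε → Positive ε → ∃[ K ] (ι C < ι K * ε)
archimedean C ε@(mkℚ (+ suc p) d _) _ = suc C ℕ.* suc d , (begin-strict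
  ι C                              <⟨ subst (_< ι C + 1ℚ) (+-identityʳ (ι C)) (+-monoʳ-< (ι C) (positive⁻¹ 1ℚ)) ⟩
  ι C + 1ℚ                         ≡⟨ ι-suc C ⟨
  ι (suc C)                        ≡⟨ *-identityʳ (ι (suc C)) ⟨
  ι (suc C) * 1ℚ                   ≤⟨ *-monoˡ-≤-0≤ (ι (suc C)) (0≤ι (suc C)) (ι-mono-≤ {1} {suc p} (s≤s z≤n)) ⟩
  ι (suc C) * ι (suc p)            ≡⟨ cong (ι (suc C) *_) ε*d≡p ⟨
  ι (suc C) * (ε * ι (suc d))      ≡⟨ regroup (ι (suc C)) ε (ι (suc d)) ⟩
  ι (suc C) * ι (suc d) * ε        ≡⟨ cong (_* ε) (ι-homo-* (suc C) (suc d)) ⟨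
  ι (suc C ℕ.* suc d) * ε ∎)
  where
  open ≤-Reasoning
  ε*d≡p : ε * ι (suc d) ≡ ι (suc p)
  ε*d≡p = subst (λ x → x * ι (suc d) ≡ ι (suc p)) (↥p/↧p≡p ε) (a⁄d*d≡a (suc p) (suc d))
  regroup : ∀ c e d → c * (e * d) ≡ c * d * e
  regroup = solve-∀ ℚ-ring

null-from-1/N : ∀ {a} C → (∀ N → ∣ a N ∣ * ι N ≤ ι C) → Null a
null-from-1/N {a} C bound ε ε>0 with archimedean C ε ε>0
... | K , C<Kε = K , λ N N≥K → *-cancelʳ-<-nonNeg (ι N) {{nonNegative (0≤ι N)}} (begin-strict
  ∣ a N ∣ * ι N   ≤⟨ bound N ⟩
  ι C             <⟨ C<Kε ⟩
  ι K * ε         ≤⟨ *-monoʳ-≤-0≤ ε (<⇒≤ (positive⁻¹ ε {{ε>0}})) (ι-mono-≤ N≥K) ⟩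
  ι N * ε         ≡⟨ *-comm (ι N) ε ⟩
  ε * ι N ∎)
  where open ≤-Reasoning

null-sqrt : ∀ {a} → Null (λ N → a N * a N) → Null a
null-sqrt {a} null-a² ε ε>0 with null-a² (ε * ε) (pos*pos⇒pos ε {{ε>0}} ε {{ε>0}})
... | N₀ , small = N₀ , λ N N≥N₀ → root (small N N≥N₀)
  where
  root : ∀ {x} → ∣ x * x ∣ < ε * ε → ∣ x ∣ < ε
  root {x} ∣x²∣<ε² with ∣ x ∣ <? ε
  ... | yes ∣x∣<ε = ∣x∣<ε
  ... | no  ∣x∣≮ε = ⊥-elim (<-irrefl refl (<-≤-trans ∣x²∣<ε² (begin
    ε * ε             ≤⟨ *-mono-≤-0≤ 0≤ε 0≤ε (≮⇒≥ ∣x∣≮ε) (≮⇒≥ ∣x∣≮ε) ⟩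
    ∣ x ∣ * ∣ x ∣     ≡⟨ ∣p*q∣≡∣p∣*∣q∣ x x ⟨
    ∣ x * x ∣ ∎)))
    where
    open ≤-Reasoning
    0≤ε : 0ℚ ≤ ε
    0≤ε = <⇒≤ (positive⁻¹ ε {{ε>0}})

-- The terms of the series

2[1+j]∸1≡1+2j : ∀ j → 2 ℕ.* suc j ℕ.∸ 1 ≡ suc (2 ℕ.* j)
2[1+j]∸1≡1+2j j = cong (ℕ._∸ 1) (ℕ.*-suc 2 j)

-- Only used at j ≥ 1: recipOdd 0 is the junk value 1 ⁄ 0 = 0.
recipOdd : ℕ → ℚ
recipOdd j = (+ 1) ⁄ (2 ℕ.* j ℕ.∸ 1)

recipOddSquare : ℕ → ℚ
recipOddSquare j = (+ 1) ⁄ ((2 ℕ.* j ℕ.∸ 1) ℕ.* (2 ℕ.* j ℕ.∸ 1))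

0≤recipOdd : ∀ j → 0ℚ ≤ recipOdd j
0≤recipOdd j = 0≤a⁄d 1 (2 ℕ.* j ℕ.∸ 1)

recipOdd-inverse : ∀ j → recipOdd (suc j) * (ι 2 * ι j + 1ℚ) ≡ 1ℚ
recipOdd-inverse j = begin
  ((+ 1) ⁄ (2 ℕ.* suc j ℕ.∸ 1)) * (ι 2 * ι j + 1ℚ)  ≡⟨ cong (λ d → ((+ 1) ⁄ d) * (ι 2 * ι j + 1ℚ)) (2[1+j]∸1≡1+2j j) ⟩
  ((+ 1) ⁄ suc (2 ℕ.* j)) * (ι 2 * ι j + 1ℚ)        ≡⟨ cong (((+ 1) ⁄ suc (2 ℕ.* j)) *_) (ι-1+2j j) ⟨
  ((+ 1) ⁄ suc (2 ℕ.* j)) * ι (suc (2 ℕ.* j))       ≡⟨ a⁄d*d≡a 1 (suc (2 ℕ.* j)) ⟩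
  1ℚ ∎
  where open ≡-Reasoning

recipOddSquare-inverse : ∀ j → recipOddSquare (suc j) * ((ι 2 * ι j + 1ℚ) * (ι 2 * ι j + 1ℚ)) ≡ 1ℚ
recipOddSquare-inverse j = begin
  ((+ 1) ⁄ (d ℕ.* d)) * (B * B)  ≡⟨ cong (λ d → ((+ 1) ⁄ (d ℕ.* d)) * (B * B)) (2[1+j]∸1≡1+2j j) ⟩
  ((+ 1) ⁄ (o ℕ.* o)) * (B * B)  ≡⟨ cong (((+ 1) ⁄ (o ℕ.* o)) *_) (trans (ι-homo-* o o) (cong₂ _*_ (ι-1+2j j) (ι-1+2j j))) ⟨
  ((+ 1) ⁄ (o ℕ.* o)) * ι (o ℕ.* o) ≡⟨ a⁄d*d≡a 1 (o ℕ.* o) ⟩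
  1ℚ ∎
  where
  open ≡-Reasoning
  d = 2 ℕ.* suc j ℕ.∸ 1
  o = suc (2 ℕ.* j)
  B = ι 2 * ι j + 1ℚ

recipOdd-step : ∀ i → recipOdd (suc i) - recipOdd (2 ℕ.+ i) ≡ ι 2 * (recipOdd (suc i) * recipOdd (2 ℕ.+ i))
recipOdd-step i = begin
  r - r′                                                ≡⟨ units r r′ ⟩
  r * 1ℚ - r′ * 1ℚ                                      ≡⟨ cong₂ (λ x y → r * x - r′ * y) (recipOdd-inverse (suc i)) (recipOdd-inverse i) ⟨
  r * (r′ * (ι 2 * ι (suc i) + 1ℚ)) - r′ * (r * (ι 2 * ι i + 1ℚ))
    ≡⟨ cong (λ x → r * (r′ * (ι 2 * x + 1ℚ)) - r′ * (r * (ι 2 * ι i + 1ℚ))) (ι-suc i) ⟩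
  r * (r′ * (ι 2 * (ι i + 1ℚ) + 1ℚ)) - r′ * (r * (ι 2 * ι i + 1ℚ)) ≡⟨ collect r r′ (ι i) ⟩
  ι 2 * (r * r′) ∎
  where
  open ≡-Reasoning
  r = recipOdd (suc i)
  r′ = recipOdd (2 ℕ.+ i)
  units : ∀ x y → x - y ≡ x * 1ℚ - y * 1ℚ
  units = solve-∀ ℚ-ring
  collect : ∀ x y J → x * (y * (ι 2 * (J + 1ℚ) + 1ℚ)) - y * (x * (ι 2 * J + 1ℚ)) ≡ ι 2 * (x * y)
  collect = solve-∀ ℚ-ring

recipOdd*N≤1 : ∀ n → recipOdd (suc n) * ι (suc n) ≤ 1ℚ
recipOdd*N≤1 n = begin
  recipOdd (suc n) * ι (suc n)               ≡⟨ cong (recipOdd (suc n) *_) (ι-suc n) ⟩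
  recipOdd (suc n) * (ι n + 1ℚ)              ≤⟨ *-monoˡ-≤-0≤ (recipOdd (suc n)) (0≤recipOdd (suc n))
                                                  (≤-by-slack (ι n) (split (ι n)) (0≤ι n)) ⟩
  recipOdd (suc n) * (ι 2 * ι n + 1ℚ)        ≡⟨ recipOdd-inverse n ⟩
  1ℚ ∎
  where
  open ≤-Reasoning
  split : ∀ x → ι 2 * x + 1ℚ ≡ x + 1ℚ + x
  split = solve-∀ ℚ-ring

central : ℕ → ℚ
central j = ι (centralBinom j)

scaledTerm : ℕ → ℕ → ℚ
scaledTerm j n = central j * term j n

term-ratio-n : ∀ j n → term j (2 ℕ.+ n) * ι ((suc n ℕ.+ 2) ℕ.* (2 ℕ.* (suc n ℕ.+ j) ℕ.+ 1))
                     ≡ term j (suc n) * ι (2 ℕ.* suc n ℕ.* (suc n ℕ.+ 1))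
term-ratio-n j n = ⁄-cross (2 ℕ.^ (2 ℕ.* (2 ℕ.+ n))) (2 ℕ.^ (2 ℕ.* suc n)) _ (2 ℕ.* suc n ℕ.* (suc n ℕ.+ 1))
                           (denom j (2 ℕ.+ n)) (denom j (suc n)) {{denom≢0 j (suc n)}} {{denom≢0 j n}}
                           (term-cross-n j (suc n))

term-ratio-n′ : ∀ j n → term j (2 ℕ.+ n) * ((ι (suc n) + ι 2) * (ι 2 * (ι (suc n) + ι j) + 1ℚ))
                      ≡ term j (suc n) * (ι 2 * ι (suc n) * (ι (suc n) + 1ℚ))
term-ratio-n′ j n = begin
  term j (2 ℕ.+ n) * ((ι (suc n) + ι 2) * (ι 2 * (ι (suc n) + ι j) + 1ℚ))
    ≡⟨ cong (term j (2 ℕ.+ n) *_) (trans (ι-homo-* (suc n ℕ.+ 2) (2 ℕ.* (suc n ℕ.+ j) ℕ.+ 1))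
                                         (cong₂ _*_ (ι-homo-+ (suc n) 2) (ι-2[m+n]+1 (suc n) j))) ⟨
  term j (2 ℕ.+ n) * ι ((suc n ℕ.+ 2) ℕ.* (2 ℕ.* (suc n ℕ.+ j) ℕ.+ 1))
    ≡⟨ term-ratio-n j n ⟩
  term j (suc n) * ι (2 ℕ.* suc n ℕ.* (suc n ℕ.+ 1))
    ≡⟨ cong (term j (suc n) *_) (trans (ι-homo-* (2 ℕ.* suc n) (suc n ℕ.+ 1))
                                       (cong₂ _*_ (ι-homo-* 2 (suc n)) (ι-homo-+ (suc n) 1))) ⟩
  term j (suc n) * (ι 2 * ι (suc n) * (ι (suc n) + 1ℚ)) ∎
  where open ≡-Reasoning

scaledTerm-ratio-j : ∀ j n → scaledTerm (suc j) (suc n) * (ι 2 * (ι (suc n) + ι j) + 1ℚ)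
                           ≡ (ι 2 * ι j + 1ℚ) * scaledTerm j (suc n)
scaledTerm-ratio-j j n = begin
  central (suc j) * t′ * K                    ≡⟨ regroup₁ (central (suc j)) t′ K ⟩
  t′ * (central (suc j) * K)                  ≡⟨ cong (λ x → t′ * (central (suc j) * x)) (ι-2[m+n]+1 (suc n) j) ⟨
  t′ * (central (suc j) * ι (2 ℕ.* (suc n ℕ.+ j) ℕ.+ 1))
    ≡⟨ cong (t′ *_) (ι-homo-* (centralBinom (suc j)) (2 ℕ.* (suc n ℕ.+ j) ℕ.+ 1)) ⟨
  t′ * ι (centralBinom (suc j) ℕ.* (2 ℕ.* (suc n ℕ.+ j) ℕ.+ 1))
    ≡⟨ ⁄-cross (2 ℕ.^ (2 ℕ.* suc n)) (2 ℕ.^ (2 ℕ.* suc n)) _ ((2 ℕ.* j ℕ.+ 1) ℕ.* centralBinom j)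
               (denom (suc j) (suc n)) (denom j (suc n)) {{denom≢0 (suc j) n}} {{denom≢0 j n}} (term-cross-j j (suc n)) ⟩
  t * ι ((2 ℕ.* j ℕ.+ 1) ℕ.* centralBinom j)
    ≡⟨ cong (t *_) (trans (ι-homo-* (2 ℕ.* j ℕ.+ 1) (centralBinom j)) (cong (_* central j) (ι-2n+1 j))) ⟩
  t * ((ι 2 * ι j + 1ℚ) * central j)          ≡⟨ regroup₂ t (ι 2 * ι j + 1ℚ) (central j) ⟩
  (ι 2 * ι j + 1ℚ) * (central j * t) ∎
  where
  open ≡-Reasoning
  t = term j (suc n)
  t′ = term (suc j) (suc n)
  K = ι 2 * (ι (suc n) + ι j) + 1ℚ
  regroup₁ : ∀ c t k → c * t * k ≡ t * (c * k)
  regroup₁ = solve-∀ ℚ-ring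
  regroup₂ : ∀ t b c → t * (b * c) ≡ b * (c * t)
  regroup₂ = solve-∀ ℚ-ring

scaledTerm-one : ∀ j → (ι 2 * ι j + 1ℚ) * scaledTerm j 1 ≡ 1ℚ
scaledTerm-one j = begin
  (ι 2 * ι j + 1ℚ) * (central j * term j 1)   ≡⟨ regroup (ι 2 * ι j + 1ℚ) (central j) (term j 1) ⟩
  term j 1 * ((ι 2 * ι j + 1ℚ) * central j)   ≡⟨ cong (λ x → term j 1 * (x * central j)) (ι-2n+1 j) ⟨
  term j 1 * (ι (2 ℕ.* j ℕ.+ 1) * central j)  ≡⟨ cong (term j 1 *_) (ι-homo-* (2 ℕ.* j ℕ.+ 1) (centralBinom j)) ⟨
  term j 1 * ι ((2 ℕ.* j ℕ.+ 1) ℕ.* centralBinom j)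
    ≡⟨ ⁄-cross (2 ℕ.^ 2) 1 ((2 ℕ.* j ℕ.+ 1) ℕ.* centralBinom j) 1 (denom j 1) 1 {{denom≢0 j 0}} (term-cross-one j) ⟩
  1ℚ ∎
  where
  open ≡-Reasoning
  regroup : ∀ b c t → b * (c * t) ≡ t * (b * c)
  regroup = solve-∀ ℚ-ring

0≤term : ∀ j n → 0ℚ ≤ term j n
0≤term j n = 0≤a⁄d (2 ℕ.^ (2 ℕ.* n)) (denom j n)

0≤scaledTerm : ∀ j n → 0ℚ ≤ scaledTerm j n
0≤scaledTerm j n = 0≤p*q (0≤ι (centralBinom j)) (0≤term j n)

term-antitone : ∀ j n → term j (2 ℕ.+ n) ≤ term j (suc n)
term-antitone j n = *-ratio⇒≤ (ι-pos x {{ℕ.m*n≢0 (suc n ℕ.+ 2) (2 ℕ.* (suc n ℕ.+ j) ℕ.+ 1) {{_}} {{2n+1≢0 (suc n ℕ.+ j)}}}})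
                              (0≤term j (suc n)) (ι-mono-≤ (2m[m+1]≤[m+2][2[m+j]+1] (suc n) j)) (term-ratio-n j n)
  where
  x = (suc n ℕ.+ 2) ℕ.* (2 ℕ.* (suc n ℕ.+ j) ℕ.+ 1)

term≤term₁ : ∀ j n → term j (suc n) ≤ term j 1
term≤term₁ j zero    = ≤-refl
term≤term₁ j (suc n) = ≤-trans (term-antitone j n) (term≤term₁ j n)

scaledTerm-antitone : ∀ j n → scaledTerm (suc j) (suc n) ≤ scaledTerm j (suc n)
scaledTerm-antitone j n = *-ratio⇒≤ (oddSum-pos (suc n) j) (0≤scaledTerm j (suc n)) B≤K
  (trans (scaledTerm-ratio-j j n) (*-comm (ι 2 * ι j + 1ℚ) (scaledTerm j (suc n))))
  where
  K = ι 2 * (ι (suc n) + ι j) + 1ℚ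
  split : ∀ M J → ι 2 * (M + J) + 1ℚ ≡ ι 2 * J + 1ℚ + ι 2 * M
  split = solve-∀ ℚ-ring
  B≤K : ι 2 * ι j + 1ℚ ≤ K
  B≤K = subst (ι 2 * ι j + 1ℚ ≤_) (sym (split (ι (suc n)) (ι j))) (p≤p+q _ (0≤p*q (0≤ι 2) (0≤ι (suc n))))

-- The defect and its recurrence in j

-- Multiplied by 2(n+j)+3, both sides become −2 (n+2) (2j+1) c_j t_j(n+1), by the two term ratios.
scaledTerm-telescoping : ∀ j n →
  (ι 2 * ι j - 1ℚ) * scaledTerm (suc j) (suc n) - (ι 2 * ι j + 1ℚ) * scaledTerm j (suc n)
    ≡ ι 2 * central j * ((ι (2 ℕ.+ n) + 1ℚ) * term j (2 ℕ.+ n) - (ι (suc n) + 1ℚ) * term j (suc n))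
scaledTerm-telescoping j n = *-cancelʳ-≡-pos K {{oddSum-pos (suc n) j}} (trans lhs (sym rhs))
  where
  open ≡-Reasoning
  J = ι j
  M = ι (suc n)
  K = ι 2 * (M + J) + 1ℚ
  c = central j
  t = term j (suc n)
  t₁ = term j (2 ℕ.+ n)
  lhs : ((ι 2 * J - 1ℚ) * scaledTerm (suc j) (suc n) - (ι 2 * J + 1ℚ) * (c * t)) * K
        ≡ - (ι 2 * (M + 1ℚ) * (ι 2 * J + 1ℚ) * (c * t))
  lhs = begin
    ((ι 2 * J - 1ℚ) * u′ - (ι 2 * J + 1ℚ) * (c * t)) * K
      ≡⟨ expand (ι 2 * J - 1ℚ) u′ (ι 2 * J + 1ℚ) (c * t) K ⟩
    (ι 2 * J - 1ℚ) * (u′ * K) - (ι 2 * J + 1ℚ) * (c * t) * K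
      ≡⟨ cong (λ x → (ι 2 * J - 1ℚ) * x - (ι 2 * J + 1ℚ) * (c * t) * K) (scaledTerm-ratio-j j n) ⟩
    (ι 2 * J - 1ℚ) * ((ι 2 * J + 1ℚ) * (c * t)) - (ι 2 * J + 1ℚ) * (c * t) * K
      ≡⟨ collect J M (c * t) ⟩
    - (ι 2 * (M + 1ℚ) * (ι 2 * J + 1ℚ) * (c * t)) ∎
    where
    u′ = scaledTerm (suc j) (suc n)
    expand : ∀ a u b v k → (a * u - b * v) * k ≡ a * (u * k) - b * v * k
    expand = solve-∀ ℚ-ring
    collect : ∀ J M u → (ι 2 * J - 1ℚ) * ((ι 2 * J + 1ℚ) * u) - (ι 2 * J + 1ℚ) * u * (ι 2 * (M + J) + 1ℚ)
                        ≡ - (ι 2 * (M + 1ℚ) * (ι 2 * J + 1ℚ) * u)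
    collect = solve-∀ ℚ-ring
  rhs : ι 2 * c * ((ι (2 ℕ.+ n) + 1ℚ) * t₁ - (M + 1ℚ) * t) * K ≡ - (ι 2 * (M + 1ℚ) * (ι 2 * J + 1ℚ) * (c * t))
  rhs = begin
    ι 2 * c * ((ι (2 ℕ.+ n) + 1ℚ) * t₁ - (M + 1ℚ) * t) * K
      ≡⟨ cong (λ x → ι 2 * c * ((x + 1ℚ) * t₁ - (M + 1ℚ) * t) * K) (ι-suc (suc n)) ⟩
    ι 2 * c * ((M + 1ℚ + 1ℚ) * t₁ - (M + 1ℚ) * t) * K
      ≡⟨ expand c M J t₁ t ⟩
    ι 2 * c * (t₁ * ((M + ι 2) * K) - (M + 1ℚ) * t * K)
      ≡⟨ cong (λ x → ι 2 * c * (x - (M + 1ℚ) * t * K)) (term-ratio-n′ j n) ⟩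
    ι 2 * c * (t * (ι 2 * M * (M + 1ℚ)) - (M + 1ℚ) * t * K)
      ≡⟨ collect c M J t ⟩
    - (ι 2 * (M + 1ℚ) * (ι 2 * J + 1ℚ) * (c * t)) ∎
    where
    expand : ∀ c M J t₁ t → ι 2 * c * ((M + 1ℚ + 1ℚ) * t₁ - (M + 1ℚ) * t) * (ι 2 * (M + J) + 1ℚ)
                         ≡ ι 2 * c * (t₁ * ((M + ι 2) * (ι 2 * (M + J) + 1ℚ)) - (M + 1ℚ) * t * (ι 2 * (M + J) + 1ℚ))
    expand = solve-∀ ℚ-ring
    collect : ∀ c M J t → ι 2 * c * (t * (ι 2 * M * (M + 1ℚ)) - (M + 1ℚ) * t * (ι 2 * (M + J) + 1ℚ))
                        ≡ - (ι 2 * (M + 1ℚ) * (ι 2 * J + 1ℚ) * (c * t))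
    collect = solve-∀ ℚ-ring

partialSum-recurrence : ∀ N j →
  (ι 2 * ι j - 1ℚ) * (central (suc j) * lhsPartial (suc j) N) - (ι 2 * ι j + 1ℚ) * (central j * lhsPartial j N)
    ≡ ι 2 * central j * ((ι (suc N) + 1ℚ) * term j (suc N) - ι 2 * term j 1)
partialSum-recurrence N j = begin
  A * (central (suc j) * Σ₁ N (term (suc j))) - B * (central j * Σ₁ N (term j))
    ≡⟨ cong₂ (λ x y → A * x - B * y) (Σ₁-*ˡ N (central (suc j)) (term (suc j))) (Σ₁-*ˡ N (central j) (term j)) ⟨
  A * Σ₁ N (scaledTerm (suc j)) - B * Σ₁ N (scaledTerm j)
    ≡⟨ Σ₁-lincomb N A B (scaledTerm (suc j)) (scaledTerm j) ⟨
  Σ₁ N (λ n → A * scaledTerm (suc j) n - B * scaledTerm j n)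
    ≡⟨ Σ₁-cong N (scaledTerm-telescoping j) ⟩
  Σ₁ N (λ n → k * (h (suc n) - h n))
    ≡⟨ Σ₁-*ˡ N k (λ n → h (suc n) - h n) ⟩
  k * Σ₁ N (λ n → h (suc n) - h n)
    ≡⟨ cong (k *_) (Σ₁-telescope N h) ⟩
  k * (h (suc N) - h 1) ∎
  where
  open ≡-Reasoning
  A = ι 2 * ι j - 1ℚ
  B = ι 2 * ι j + 1ℚ
  k = ι 2 * central j
  h : ℕ → ℚ
  h n = (ι n + 1ℚ) * term j n

defect : ℕ → ℕ → ℚ
defect N j = central j * lhsPartial j N - 1ℚ - (ι j - ½) * (ι 4 * O2 j - ι 3 * zeta2Partial N)

boundary : ℕ → ℕ → ℚ
boundary N j = ι 2 * (ι (suc N) + 1ℚ) * scaledTerm j (suc N)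

-- This is 2 − 4 / (2j+1) − 2 (2j−1) / (2j+1) = 0, as c_j t_j(1) = 1 / (2j+1).
defect-constants : ∀ j → ι 2 - ι 4 * scaledTerm j 1 - ι 2 * (ι 2 * ι j - 1ℚ) * ((ι 2 * ι j + 1ℚ) * recipOddSquare (suc j))
                         ≡ 0ℚ
defect-constants j = *-cancelʳ-≡-pos B {{odd-pos j}} (begin
  (ι 2 - ι 4 * τ - ι 2 * A * (B * w)) * B          ≡⟨ expand (ι j) τ w ⟩
  ι 2 * B - ι 4 * (B * τ) - ι 2 * A * (w * (B * B))
    ≡⟨ cong₂ (λ x y → ι 2 * B - ι 4 * x - ι 2 * A * y) (scaledTerm-one j) (recipOddSquare-inverse j) ⟩
  ι 2 * B - ι 4 * 1ℚ - ι 2 * A * 1ℚ                ≡⟨ vanish (ι j) ⟩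
  0ℚ * B ∎)
  where
  open ≡-Reasoning
  A = ι 2 * ι j - 1ℚ
  B = ι 2 * ι j + 1ℚ
  τ = scaledTerm j 1
  w = recipOddSquare (suc j)
  expand : ∀ J τ w → (ι 2 - ι 4 * τ - ι 2 * (ι 2 * J - 1ℚ) * ((ι 2 * J + 1ℚ) * w)) * (ι 2 * J + 1ℚ)
                   ≡ ι 2 * (ι 2 * J + 1ℚ) - ι 4 * ((ι 2 * J + 1ℚ) * τ) - ι 2 * (ι 2 * J - 1ℚ) * (w * ((ι 2 * J + 1ℚ) * (ι 2 * J + 1ℚ)))
  expand = solve-∀ ℚ-ring
  vanish : ∀ J → ι 2 * (ι 2 * J + 1ℚ) - ι 4 * 1ℚ - ι 2 * (ι 2 * J - 1ℚ) * 1ℚ ≡ 0ℚ * (ι 2 * J + 1ℚ)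
  vanish = solve-∀ ℚ-ring

-- The ζ-terms cancel because (2j−1)(j+½) = (2j+1)(j−½).
defect-recurrence : ∀ N j → (ι 2 * ι j - 1ℚ) * defect N (suc j) ≡ (ι 2 * ι j + 1ℚ) * defect N j + boundary N j
defect-recurrence N j = begin
  A * (S′ - 1ℚ - (ι (suc j) - ½) * (ι 4 * (O + w) - ι 3 * Z))
    ≡⟨ cong (λ x → A * (S′ - 1ℚ - (x - ½) * (ι 4 * (O + w) - ι 3 * Z))) (ι-suc j) ⟩
  A * (S′ - 1ℚ - (J + 1ℚ - ½) * (ι 4 * (O + w) - ι 3 * Z))
    ≡⟨ separate J S′ S O w Z ⟩
  B * defect N j + (A * S′ - B * S) + (ι 2 - ι 2 * A * (B * w))
    ≡⟨ cong (λ x → B * defect N j + x + (ι 2 - ι 2 * A * (B * w))) (partialSum-recurrence N j) ⟩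
  B * defect N j + ι 2 * c * ((M + 1ℚ) * t - ι 2 * t₁) + (ι 2 - ι 2 * A * (B * w))
    ≡⟨ regroup (B * defect N j) c M t t₁ J w ⟩
  B * defect N j + boundary N j + (ι 2 - ι 4 * (c * t₁) - ι 2 * A * (B * w))
    ≡⟨ cong (λ x → B * defect N j + boundary N j + x) (defect-constants j) ⟩
  B * defect N j + boundary N j + 0ℚ
    ≡⟨ +-identityʳ _ ⟩
  B * defect N j + boundary N j ∎
  where
  open ≡-Reasoning
  J = ι j
  A = ι 2 * J - 1ℚ
  B = ι 2 * J + 1ℚ
  M = ι (suc N)
  c = central j
  t = term j (suc N)
  t₁ = term j 1
  S = c * lhsPartial j N
  S′ = central (suc j) * lhsPartial (suc j) N
  O = O2 j
  w = recipOddSquare (suc j)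
  Z = zeta2Partial N
  separate : ∀ J S′ S O w Z →
    (ι 2 * J - 1ℚ) * (S′ - 1ℚ - (J + 1ℚ - ½) * (ι 4 * (O + w) - ι 3 * Z))
      ≡ (ι 2 * J + 1ℚ) * (S - 1ℚ - (J - ½) * (ι 4 * O - ι 3 * Z))
        + ((ι 2 * J - 1ℚ) * S′ - (ι 2 * J + 1ℚ) * S)
        + (ι 2 - ι 2 * (ι 2 * J - 1ℚ) * ((ι 2 * J + 1ℚ) * w))
  separate = solve-∀ ℚ-ring
  regroup : ∀ e c M t t₁ J w →
    e + ι 2 * c * ((M + 1ℚ) * t - ι 2 * t₁) + (ι 2 - ι 2 * (ι 2 * J - 1ℚ) * ((ι 2 * J + 1ℚ) * w))
      ≡ e + ι 2 * (M + 1ℚ) * (c * t) + (ι 2 - ι 4 * (c * t₁) - ι 2 * (ι 2 * J - 1ℚ) * ((ι 2 * J + 1ℚ) * w))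
  regroup = solve-∀ ℚ-ring

-- Bounds on the defect

0≤lhsPartial : ∀ j N → 0ℚ ≤ lhsPartial j N
0≤lhsPartial j zero    = ≤-refl
0≤lhsPartial j (suc N) = +-mono-≤ (0≤lhsPartial j N) (0≤term j (suc N))

lhsPartial≤N*term₁ : ∀ j N → lhsPartial j N ≤ ι N * term j 1
lhsPartial≤N*term₁ j zero    = ≤-reflexive (sym (*-zeroˡ (term j 1)))
lhsPartial≤N*term₁ j (suc N) = begin
  lhsPartial j N + term j (suc N) ≤⟨ +-mono-≤ (lhsPartial≤N*term₁ j N) (term≤term₁ j N) ⟩
  ι N * term j 1 + term j 1       ≡⟨ collect (ι N) (term j 1) ⟩
  (ι N + 1ℚ) * term j 1           ≡⟨ cong (_* term j 1) (ι-suc N) ⟨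
  ι (suc N) * term j 1 ∎
  where
  open ≤-Reasoning
  collect : ∀ x t → x * t + t ≡ (x + 1ℚ) * t
  collect = solve-∀ ℚ-ring

central*lhsPartial≤1 : ∀ N → central N * lhsPartial N N ≤ 1ℚ
central*lhsPartial≤1 N = begin
  central N * lhsPartial N N            ≤⟨ *-monoˡ-≤-0≤ (central N) (0≤ι (centralBinom N)) (lhsPartial≤N*term₁ N N) ⟩
  central N * (ι N * term N 1)
    ≤⟨ *-monoˡ-≤-0≤ (central N) (0≤ι (centralBinom N)) (*-monoʳ-≤-0≤ (term N 1) (0≤term N 1) N≤2N+1) ⟩
  central N * ((ι 2 * ι N + 1ℚ) * term N 1) ≡⟨ regroup (central N) (ι 2 * ι N + 1ℚ) (term N 1) ⟩
  (ι 2 * ι N + 1ℚ) * scaledTerm N 1     ≡⟨ scaledTerm-one N ⟩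
  1ℚ ∎
  where
  open ≤-Reasoning
  split : ∀ x → ι 2 * x + 1ℚ ≡ x + (x + 1ℚ)
  split = solve-∀ ℚ-ring
  N≤2N+1 : ι N ≤ ι 2 * ι N + 1ℚ
  N≤2N+1 = ≤-by-slack (ι N + 1ℚ) (split (ι N)) (0≤ι+1 N)
  regroup : ∀ c b t → c * (b * t) ≡ b * (c * t)
  regroup = solve-∀ ℚ-ring

0≤boundary : ∀ N j → 0ℚ ≤ boundary N j
0≤boundary N j = 0≤p*q (0≤p*q (0≤ι 2) (0≤ι+1 (suc N))) (0≤scaledTerm j (suc N))

boundary≤boundary₀ : ∀ N j → boundary N j ≤ boundary N 0
boundary≤boundary₀ N zero    = ≤-refl
boundary≤boundary₀ N (suc j) = ≤-trans (*-monoˡ-≤-0≤ κ 0≤κ (scaledTerm-antitone j N)) (boundary≤boundary₀ N j)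
  where
  κ = ι 2 * (ι (suc N) + 1ℚ)
  0≤κ : 0ℚ ≤ κ
  0≤κ = 0≤p*q (0≤ι 2) (0≤ι+1 (suc N))

reducedDefect : ℕ → ℕ → ℚ
reducedDefect N j = defect N j * recipOdd j

defect≡reducedDefect*odd : ∀ N i → defect N (suc i) ≡ reducedDefect N (suc i) * (ι 2 * ι i + 1ℚ)
defect≡reducedDefect*odd N i = begin
  defect N (suc i)                                        ≡⟨ *-identityʳ _ ⟨
  defect N (suc i) * 1ℚ                                   ≡⟨ cong (defect N (suc i) *_) (recipOdd-inverse i) ⟨
  defect N (suc i) * (recipOdd (suc i) * (ι 2 * ι i + 1ℚ)) ≡⟨ *-assoc (defect N (suc i)) _ _ ⟨
  reducedDefect N (suc i) * (ι 2 * ι i + 1ℚ) ∎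
  where open ≡-Reasoning

reducedDefect-step : ∀ N i → reducedDefect N (2 ℕ.+ i) - reducedDefect N (suc i)
                           ≡ boundary N (suc i) * (recipOdd (suc i) * recipOdd (2 ℕ.+ i))
reducedDefect-step N i = begin
  E′ * r′ - E * r                                   ≡⟨ cong (_- E * r) (*-identityʳ (E′ * r′)) ⟨
  E′ * r′ * 1ℚ - E * r                              ≡⟨ cong (λ x → E′ * r′ * x - E * r) (recipOdd-inverse i) ⟨
  E′ * r′ * (r * (ι 2 * ι i + 1ℚ)) - E * r          ≡⟨ expand E′ r′ r (ι i) E ⟩
  ((ι 2 * (ι i + 1ℚ) - 1ℚ) * E′) * (r * r′) - E * r ≡⟨ cong (λ x → ((ι 2 * x - 1ℚ) * E′) * (r * r′) - E * r) (ι-suc i) ⟨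
  ((ι 2 * ι (suc i) - 1ℚ) * E′) * (r * r′) - E * r ≡⟨ cong (λ x → x * (r * r′) - E * r) (defect-recurrence N (suc i)) ⟩
  ((ι 2 * ι (suc i) + 1ℚ) * E + β) * (r * r′) - E * r
    ≡⟨ collect (ι 2 * ι (suc i) + 1ℚ) E β r r′ ⟩
  E * r * (r′ * (ι 2 * ι (suc i) + 1ℚ)) - E * r + β * (r * r′)
    ≡⟨ cong (λ x → E * r * x - E * r + β * (r * r′)) (recipOdd-inverse (suc i)) ⟩
  E * r * 1ℚ - E * r + β * (r * r′)                 ≡⟨ cancel (E * r) (β * (r * r′)) ⟩
  β * (r * r′) ∎
  where
  open ≡-Reasoning
  E = defect N (suc i)
  E′ = defect N (2 ℕ.+ i)
  r = recipOdd (suc i)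
  r′ = recipOdd (2 ℕ.+ i)
  β = boundary N (suc i)
  expand : ∀ e r′ r J e₀ → e * r′ * (r * (ι 2 * J + 1ℚ)) - e₀ * r ≡ ((ι 2 * (J + 1ℚ) - 1ℚ) * e) * (r * r′) - e₀ * r
  expand = solve-∀ ℚ-ring
  collect : ∀ b e β r r′ → (b * e + β) * (r * r′) - e * r ≡ e * r * (r′ * b) - e * r + β * (r * r′)
  collect = solve-∀ ℚ-ring
  cancel : ∀ x y → x * 1ℚ - x + y ≡ y
  cancel = solve-∀ ℚ-ring

reducedDefect-increment : ∀ N i → ∣ reducedDefect N (2 ℕ.+ i) - reducedDefect N (suc i) ∣
                                 ≤ ½ * boundary N 0 * recipOdd (suc i) - ½ * boundary N 0 * recipOdd (2 ℕ.+ i)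
reducedDefect-increment N i = begin
  ∣ reducedDefect N (2 ℕ.+ i) - reducedDefect N (suc i) ∣ ≡⟨ cong ∣_∣ (reducedDefect-step N i) ⟩
  ∣ β * (r * r′) ∣                  ≡⟨ 0≤p⇒∣p∣≡p (0≤p*q (0≤boundary N (suc i)) 0≤rr′) ⟩
  β * (r * r′)                      ≤⟨ *-monoʳ-≤-0≤ (r * r′) 0≤rr′ (boundary≤boundary₀ N (suc i)) ⟩
  β₀ * (r * r′)                     ≡⟨ halve β₀ (r * r′) ⟩
  ½ * β₀ * (ι 2 * (r * r′))         ≡⟨ cong (½ * β₀ *_) (recipOdd-step i) ⟨
  ½ * β₀ * (r - r′)                 ≡⟨ distrib (½ * β₀) r r′ ⟩
  ½ * β₀ * r - ½ * β₀ * r′ ∎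
  where
  open ≤-Reasoning
  β = boundary N (suc i)
  β₀ = boundary N 0
  r = recipOdd (suc i)
  r′ = recipOdd (2 ℕ.+ i)
  0≤rr′ : 0ℚ ≤ r * r′
  0≤rr′ = 0≤p*q (0≤recipOdd (suc i)) (0≤recipOdd (2 ℕ.+ i))
  halve : ∀ b x → b * x ≡ ½ * b * (ι 2 * x)
  halve = solve-∀ ℚ-ring
  distrib : ∀ c x y → c * (x - y) ≡ c * x - c * y
  distrib = solve-∀ ℚ-ring

∣reducedDefect∣≤ : ∀ n i → i ℕ.≤ n → ∣ reducedDefect (suc n) (suc i) ∣
                     ≤ ∣ reducedDefect (suc n) (suc n) ∣ + ½ * boundary (suc n) 0 * recipOdd (suc i)
∣reducedDefect∣≤ n i i≤n = begin
  ∣ q (suc i) ∣                                   ≤⟨ ∣p∣≤∣q∣+∣q-p∣ (q (suc i)) (q (suc n)) ⟩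
  ∣ q (suc n) ∣ + ∣ q (suc n) - q (suc i) ∣        ≡⟨ cong (λ k → ∣ q (suc n) ∣ + ∣ q (suc k) - q (suc i) ∣) (ℕ.m∸n+n≡m i≤n) ⟨
  ∣ q (suc n) ∣ + ∣ q (suc (n ℕ.∸ i ℕ.+ i)) - q (suc i) ∣
    ≤⟨ +-monoʳ-≤ ∣ q (suc n) ∣ (telescoping-≤ (λ k → q (suc k)) b (reducedDefect-increment (suc n)) i (n ℕ.∸ i)) ⟩
  ∣ q (suc n) ∣ + (b i - b (n ℕ.∸ i ℕ.+ i))       ≤⟨ +-monoʳ-≤ ∣ q (suc n) ∣ (p-q≤p (b i) (0≤b (n ℕ.∸ i ℕ.+ i))) ⟩
  ∣ q (suc n) ∣ + b i ∎
  where
  open ≤-Reasoning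
  q = reducedDefect (suc n)
  b : ℕ → ℚ
  b k = ½ * boundary (suc n) 0 * recipOdd (suc k)
  0≤b : ∀ k → 0ℚ ≤ b k
  0≤b k = 0≤p*q (0≤p*q (nonNegative⁻¹ ½) (0≤boundary (suc n) 0)) (0≤recipOdd (suc k))

∣defect-suc∣≤ : ∀ n i → i ℕ.≤ n → ∣ defect (suc n) (suc i) ∣
                  ≤ (ι 2 * ι i + 1ℚ) * ∣ reducedDefect (suc n) (suc n) ∣ + ½ * boundary (suc n) 0
∣defect-suc∣≤ n i i≤n = begin
  ∣ defect (suc n) (suc i) ∣     ≡⟨ cong ∣_∣ (defect≡reducedDefect*odd (suc n) i) ⟩
  ∣ q * A ∣                      ≡⟨ ∣p*q∣≡∣p∣*∣q∣ q A ⟩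
  ∣ q ∣ * ∣ A ∣                  ≡⟨ cong (∣ q ∣ *_) (0≤p⇒∣p∣≡p 0≤A) ⟩
  ∣ q ∣ * A                      ≤⟨ *-monoʳ-≤-0≤ A 0≤A (∣reducedDefect∣≤ n i i≤n) ⟩
  (∣ Q ∣ + ½ * β₀ * r) * A       ≡⟨ regroup ∣ Q ∣ (½ * β₀) r A ⟩
  A * ∣ Q ∣ + ½ * β₀ * (r * A)   ≡⟨ cong (λ x → A * ∣ Q ∣ + ½ * β₀ * x) (recipOdd-inverse i) ⟩
  A * ∣ Q ∣ + ½ * β₀ * 1ℚ        ≡⟨ cong (λ x → A * ∣ Q ∣ + x) (*-identityʳ (½ * β₀)) ⟩
  A * ∣ Q ∣ + ½ * β₀ ∎
  where
  open ≤-Reasoning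
  q = reducedDefect (suc n) (suc i)
  Q = reducedDefect (suc n) (suc n)
  A = ι 2 * ι i + 1ℚ
  β₀ = boundary (suc n) 0
  r = recipOdd (suc i)
  0≤A : 0ℚ ≤ A
  0≤A = <⇒≤ (positive⁻¹ A {{odd-pos i}})
  regroup : ∀ x h r a → (x + h * r) * a ≡ a * x + h * (r * a)
  regroup = solve-∀ ℚ-ring

∣defect∣≤ : ∀ n m → m ℕ.≤ suc n → ∣ defect (suc n) m ∣
              ≤ (ι 2 * ι m + 1ℚ) * ∣ reducedDefect (suc n) (suc n) ∣ + ι 2 * boundary (suc n) 0
∣defect∣≤ n (suc i) (s≤s i≤n) = begin
  ∣ defect (suc n) (suc i) ∣              ≤⟨ ∣defect-suc∣≤ n i i≤n ⟩
  (ι 2 * ι i + 1ℚ) * ∣ Q ∣ + ½ * β₀       ≤⟨ ≤-by-slack (ι 2 * ∣ Q ∣ + ι 3 * ½ * β₀) (slack (ι i) ∣ Q ∣ β₀) 0≤slack ⟩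
  (ι 2 * (ι i + 1ℚ) + 1ℚ) * ∣ Q ∣ + ι 2 * β₀ ≡⟨ cong (λ x → (ι 2 * x + 1ℚ) * ∣ Q ∣ + ι 2 * β₀) (ι-suc i) ⟨
  (ι 2 * ι (suc i) + 1ℚ) * ∣ Q ∣ + ι 2 * β₀ ∎
  where
  open ≤-Reasoning
  Q = reducedDefect (suc n) (suc n)
  β₀ = boundary (suc n) 0
  slack : ∀ J x b → (ι 2 * (J + 1ℚ) + 1ℚ) * x + ι 2 * b ≡ (ι 2 * J + 1ℚ) * x + ½ * b + (ι 2 * x + ι 3 * ½ * b)
  slack = solve-∀ ℚ-ring
  0≤slack : 0ℚ ≤ ι 2 * ∣ Q ∣ + ι 3 * ½ * β₀
  0≤slack = +-mono-≤ (0≤p*q (0≤ι 2) (0≤∣p∣ Q)) (0≤p*q (0≤p*q (0≤ι 3) (nonNegative⁻¹ ½)) (0≤boundary (suc n) 0))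
∣defect∣≤ n zero z≤n = begin
  ∣ defect (suc n) 0 ∣               ≡⟨ cong ∣_∣ E₀≡ ⟩
  ∣ - E₁ - β₀ ∣                      ≤⟨ ∣p-q∣≤∣p∣+∣q∣ (- E₁) β₀ ⟩
  ∣ - E₁ ∣ + ∣ β₀ ∣                  ≡⟨ cong₂ _+_ (∣-p∣≡∣p∣ E₁) (0≤p⇒∣p∣≡p (0≤boundary (suc n) 0)) ⟩
  ∣ E₁ ∣ + β₀                        ≤⟨ +-monoˡ-≤ β₀ (∣defect-suc∣≤ n 0 z≤n) ⟩
  (ι 2 * ι 0 + 1ℚ) * ∣ Q ∣ + ½ * β₀ + β₀
    ≤⟨ ≤-by-slack (½ * β₀) (slack ∣ Q ∣ β₀) (0≤p*q (nonNegative⁻¹ ½) (0≤boundary (suc n) 0)) ⟩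
  (ι 2 * ι 0 + 1ℚ) * ∣ Q ∣ + ι 2 * β₀ ∎
  where
  open ≤-Reasoning
  Q = reducedDefect (suc n) (suc n)
  β₀ = boundary (suc n) 0
  E₀ = defect (suc n) 0
  E₁ = defect (suc n) 1
  E₀≡ : E₀ ≡ - E₁ - β₀
  E₀≡ = begin-equality
    E₀                                           ≡⟨ add-sub E₀ β₀ ⟩
    (ι 2 * ι 0 + 1ℚ) * E₀ + β₀ - β₀              ≡⟨ cong (_- β₀) (defect-recurrence (suc n) 0) ⟨
    (ι 2 * ι 0 - 1ℚ) * E₁ - β₀                   ≡⟨ negate E₁ β₀ ⟩
    - E₁ - β₀ ∎
    where
    add-sub : ∀ e b → e ≡ (ι 2 * ι 0 + 1ℚ) * e + b - b
    add-sub = solve-∀ ℚ-ring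
    negate : ∀ e b → (ι 2 * ι 0 - 1ℚ) * e - b ≡ - e - b
    negate = solve-∀ ℚ-ring
  slack : ∀ x b → (ι 2 * ι 0 + 1ℚ) * x + ι 2 * b ≡ (ι 2 * ι 0 + 1ℚ) * x + ½ * b + b + ½ * b
  slack = solve-∀ ℚ-ring

1⁄[k+1][k+2] : ∀ k → (+ 1) ⁄ (suc k ℕ.* suc (suc k)) ≡ (+ 1) ⁄ suc k - (+ 1) ⁄ suc (suc k)
1⁄[k+1][k+2] k = *-cancelʳ-≡-pos (a * b) {{pos*pos⇒pos a {{ι-pos (suc k)}} b {{ι-pos (suc (suc k))}}}} (begin
  (+ 1) ⁄ (suc k ℕ.* suc (suc k)) * (a * b)   ≡⟨ cong ((+ 1) ⁄ (suc k ℕ.* suc (suc k)) *_) (ι-homo-* (suc k) (suc (suc k))) ⟨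
  (+ 1) ⁄ (suc k ℕ.* suc (suc k)) * ι (suc k ℕ.* suc (suc k)) ≡⟨ a⁄d*d≡a 1 (suc k ℕ.* suc (suc k)) ⟩
  1ℚ                                          ≡⟨ unit a ⟩
  (a + 1ℚ) * 1ℚ - 1ℚ * a
    ≡⟨ cong₂ (λ x y → (a + 1ℚ) * x - y * a) (a⁄d*d≡a 1 (suc k)) (a⁄d*d≡a 1 (suc (suc k))) ⟨
  (a + 1ℚ) * (u * a) - (v * b) * a            ≡⟨ cong (λ x → (a + 1ℚ) * (u * a) - (v * x) * a) (ι-suc (suc k)) ⟩
  (a + 1ℚ) * (u * a) - (v * (a + 1ℚ)) * a     ≡⟨ regroup u v a ⟩
  (u - v) * (a * (a + 1ℚ))                    ≡⟨ cong (λ x → (u - v) * (a * x)) (ι-suc (suc k)) ⟨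
  (u - v) * (a * b) ∎)
  where
  open ≡-Reasoning
  a = ι (suc k)
  b = ι (suc (suc k))
  u = (+ 1) ⁄ suc k
  v = (+ 1) ⁄ suc (suc k)
  unit : ∀ a → 1ℚ ≡ (a + 1ℚ) * 1ℚ - 1ℚ * a
  unit = solve-∀ ℚ-ring
  regroup : ∀ u v a → (a + 1ℚ) * (u * a) - (v * (a + 1ℚ)) * a ≡ (u - v) * (a * (a + 1ℚ))
  regroup = solve-∀ ℚ-ring

zeta2Partial-increment : ∀ i → ∣ zeta2Partial (2 ℕ.+ i) - zeta2Partial (suc i) ∣ ≤ (+ 1) ⁄ suc i - (+ 1) ⁄ suc (suc i)
zeta2Partial-increment i = begin
  ∣ zeta2Partial (2 ℕ.+ i) - zeta2Partial (suc i) ∣  ≡⟨ cong ∣_∣ (add-sub (zeta2Partial (suc i)) s) ⟩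
  ∣ s ∣                                              ≡⟨ 0≤p⇒∣p∣≡p (0≤a⁄d 1 (suc (suc i) ℕ.* suc (suc i))) ⟩
  s                                                  ≤⟨ ⁄-antitone 1 (ℕ.*-monoˡ-≤ (suc (suc i)) (ℕ.n≤1+n (suc i))) ⟩
  (+ 1) ⁄ (suc i ℕ.* suc (suc i))                    ≡⟨ 1⁄[k+1][k+2] i ⟩
  (+ 1) ⁄ suc i - (+ 1) ⁄ suc (suc i) ∎
  where
  open ≤-Reasoning
  s = (+ 1) ⁄ (suc (suc i) ℕ.* suc (suc i))
  add-sub : ∀ z s → z + s - z ≡ s
  add-sub = solve-∀ ℚ-ring

zeta2Partial-tail : ∀ n → ∣ zeta2Partial (2 ℕ.* suc n) - zeta2Partial (suc n) ∣ * ι (suc n) ≤ 1ℚ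
zeta2Partial-tail n = begin
  ∣ zeta2Partial (2 ℕ.* suc n) - zeta2Partial (suc n) ∣ * ι (suc n)
    ≡⟨ cong (λ k → ∣ zeta2Partial k - zeta2Partial (suc n) ∣ * ι (suc n)) 2[1+n]≡suc[1+n+n] ⟩
  ∣ zeta2Partial (suc (suc n ℕ.+ n)) - zeta2Partial (suc n) ∣ * ι (suc n)
    ≤⟨ *-monoʳ-≤-0≤ (ι (suc n)) (0≤ι (suc n)) (telescoping-≤ (λ i → zeta2Partial (suc i)) b zeta2Partial-increment n (suc n)) ⟩
  (b n - b (suc n ℕ.+ n)) * ι (suc n)
    ≤⟨ *-monoʳ-≤-0≤ (ι (suc n)) (0≤ι (suc n)) (p-q≤p (b n) (0≤a⁄d 1 (suc (suc n ℕ.+ n)))) ⟩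
  b n * ι (suc n) ≡⟨ a⁄d*d≡a 1 (suc n) ⟩
  1ℚ ∎
  where
  open ≤-Reasoning
  b : ℕ → ℚ
  b i = (+ 1) ⁄ suc i
  2[1+n]≡suc[1+n+n] : 2 ℕ.* suc n ≡ suc (suc n ℕ.+ n)
  2[1+n]≡suc[1+n+n] = cong suc (trans (ℕ.+-suc n (n ℕ.+ 0)) (cong (λ x → suc (n ℕ.+ x)) (ℕ.+-identityʳ n)))

ι4*1⁄[2+2k]² : ∀ k → ι 4 * (+ 1) ⁄ (suc (suc (2 ℕ.* k)) ℕ.* suc (suc (2 ℕ.* k))) ≡ (+ 1) ⁄ (suc k ℕ.* suc k)
ι4*1⁄[2+2k]² k = begin
  ι 4 * (+ 1) ⁄ (d ℕ.* d)      ≡⟨ *-comm (ι 4) ((+ 1) ⁄ (d ℕ.* d)) ⟩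
  (+ 1) ⁄ (d ℕ.* d) * ι 4      ≡⟨ ⁄-cross 1 1 4 1 (d ℕ.* d) (suc k ℕ.* suc k) (square k) ⟩
  (+ 1) ⁄ (suc k ℕ.* suc k) * 1ℚ ≡⟨ *-identityʳ _ ⟩
  (+ 1) ⁄ (suc k ℕ.* suc k) ∎
  where
  open ≡-Reasoning
  d = suc (suc (2 ℕ.* k))
  square : ∀ k → 1 ℕ.* 4 ℕ.* (suc k ℕ.* suc k) ≡ 1 ℕ.* 1 ℕ.* (suc (suc (2 ℕ.* k)) ℕ.* suc (suc (2 ℕ.* k)))
  square = ℕ-Solver.solve-∀

O2-via-zeta2Partial : ∀ N → ι 4 * O2 N - ι 3 * zeta2Partial N ≡ ι 4 * (zeta2Partial (2 ℕ.* N) - zeta2Partial N)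
O2-via-zeta2Partial zero    = refl
O2-via-zeta2Partial (suc N) = begin
  ι 4 * (O2 N + w) - ι 3 * (Z N + s (suc N))
    ≡⟨ split (O2 N) w (Z N) (s (suc N)) ⟩
  (ι 4 * O2 N - ι 3 * Z N) + ι 4 * w - ι 3 * s (suc N)
    ≡⟨ cong₃ (O2-via-zeta2Partial N) w≡s (sym (ι4*1⁄[2+2k]² N)) ⟩
  ι 4 * (Z (2 ℕ.* N) - Z N) + ι 4 * s (suc (2 ℕ.* N)) - ι 3 * (ι 4 * s (2 ℕ.+ 2 ℕ.* N))
    ≡⟨ merge (Z (2 ℕ.* N)) (Z N) (s (suc (2 ℕ.* N))) (s (2 ℕ.+ 2 ℕ.* N)) ⟩
  ι 4 * (Z (2 ℕ.+ 2 ℕ.* N) - (Z N + ι 4 * s (2 ℕ.+ 2 ℕ.* N)))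
    ≡⟨ cong (λ x → ι 4 * (Z (2 ℕ.+ 2 ℕ.* N) - (Z N + x))) (ι4*1⁄[2+2k]² N) ⟩
  ι 4 * (Z (2 ℕ.+ 2 ℕ.* N) - Z (suc N))
    ≡⟨ cong (λ k → ι 4 * (Z k - Z (suc N))) (ℕ.*-suc 2 N) ⟨
  ι 4 * (Z (2 ℕ.* suc N) - Z (suc N)) ∎
  where
  open ≡-Reasoning
  Z = zeta2Partial
  s : ℕ → ℚ
  s k = (+ 1) ⁄ (k ℕ.* k)
  w = recipOddSquare (suc N)
  w≡s : w ≡ s (suc (2 ℕ.* N))
  w≡s = cong (λ d → (+ 1) ⁄ (d ℕ.* d)) (2[1+j]∸1≡1+2j N)
  cong₃ : ∀ {a a′ x x′ y y′} → a ≡ a′ → x ≡ x′ → y ≡ y′ → a + ι 4 * x - ι 3 * y ≡ a′ + ι 4 * x′ - ι 3 * y′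
  cong₃ refl refl refl = refl
  split : ∀ o w z s → ι 4 * (o + w) - ι 3 * (z + s) ≡ (ι 4 * o - ι 3 * z) + ι 4 * w - ι 3 * s
  split = solve-∀ ℚ-ring
  merge : ∀ z₂ z x y → ι 4 * (z₂ - z) + ι 4 * x - ι 3 * (ι 4 * y) ≡ ι 4 * (z₂ + x + y - (z + ι 4 * y))
  merge = solve-∀ ℚ-ring

∣4O2-3zeta2Partial∣*N≤4 : ∀ n → ∣ ι 4 * O2 (suc n) - ι 3 * zeta2Partial (suc n) ∣ * ι (suc n) ≤ ι 4
∣4O2-3zeta2Partial∣*N≤4 n = begin
  ∣ ι 4 * O2 (suc n) - ι 3 * zeta2Partial (suc n) ∣ * ι (suc n) ≡⟨ cong (λ x → ∣ x ∣ * ι (suc n)) (O2-via-zeta2Partial (suc n)) ⟩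
  ∣ ι 4 * Δ ∣ * ι (suc n)       ≡⟨ cong (_* ι (suc n)) (∣p*q∣≡∣p∣*∣q∣ (ι 4) Δ) ⟩
  ι 4 * ∣ Δ ∣ * ι (suc n)       ≡⟨ *-assoc (ι 4) ∣ Δ ∣ (ι (suc n)) ⟩
  ι 4 * (∣ Δ ∣ * ι (suc n))     ≤⟨ *-monoˡ-≤-0≤ (ι 4) (0≤ι 4) (zeta2Partial-tail n) ⟩
  ι 4 * 1ℚ                      ≡⟨ *-identityʳ (ι 4) ⟩
  ι 4 ∎
  where
  open ≤-Reasoning
  Δ = zeta2Partial (2 ℕ.* suc n) - zeta2Partial (suc n)

reducedDefect-top≡ : ∀ n → reducedDefect (suc n) (suc n)
                           ≡ (central (suc n) * lhsPartial (suc n) (suc n) - 1ℚ) * recipOdd (suc n)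
                             - ½ * (ι 4 * O2 (suc n) - ι 3 * zeta2Partial (suc n))
reducedDefect-top≡ n = begin
  (U - 1ℚ - (ι (suc n) - ½) * W) * r               ≡⟨ cong (λ x → (U - 1ℚ - (x - ½) * W) * r) (ι-suc n) ⟩
  (U - 1ℚ - (ι n + 1ℚ - ½) * W) * r                ≡⟨ separate U (ι n) W r ⟩
  (U - 1ℚ) * r - ½ * W * (r * (ι 2 * ι n + 1ℚ))    ≡⟨ cong (λ x → (U - 1ℚ) * r - ½ * W * x) (recipOdd-inverse n) ⟩
  (U - 1ℚ) * r - ½ * W * 1ℚ                        ≡⟨ cong (λ x → (U - 1ℚ) * r - x) (*-identityʳ (½ * W)) ⟩
  (U - 1ℚ) * r - ½ * W ∎
  where
  open ≡-Reasoning
  U = central (suc n) * lhsPartial (suc n) (suc n)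
  W = ι 4 * O2 (suc n) - ι 3 * zeta2Partial (suc n)
  r = recipOdd (suc n)
  separate : ∀ U x W r → (U - 1ℚ - (x + 1ℚ - ½) * W) * r ≡ (U - 1ℚ) * r - ½ * W * (r * (ι 2 * x + 1ℚ))
  separate = solve-∀ ℚ-ring

∣reducedDefect-top∣*N≤3 : ∀ n → ∣ reducedDefect (suc n) (suc n) ∣ * ι (suc n) ≤ ι 3
∣reducedDefect-top∣*N≤3 n = begin
  ∣ reducedDefect (suc n) (suc n) ∣ * ι (suc n)     ≡⟨ cong (λ x → ∣ x ∣ * ι (suc n)) (reducedDefect-top≡ n) ⟩
  ∣ (U - 1ℚ) * r - ½ * W ∣ * ι (suc n)
    ≤⟨ *-monoʳ-≤-0≤ (ι (suc n)) (0≤ι (suc n)) (∣p-q∣≤∣p∣+∣q∣ ((U - 1ℚ) * r) (½ * W)) ⟩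
  (∣ (U - 1ℚ) * r ∣ + ∣ ½ * W ∣) * ι (suc n)
    ≡⟨ cong₂ (λ x y → (x + y) * ι (suc n)) ∣[U-1]r∣ (∣p*q∣≡∣p∣*∣q∣ ½ W) ⟩
  (∣ U - 1ℚ ∣ * r + ½ * ∣ W ∣) * ι (suc n)
    ≡⟨ distribute (∣ U - 1ℚ ∣) r (∣ W ∣) (ι (suc n)) ⟩
  ∣ U - 1ℚ ∣ * (r * ι (suc n)) + ½ * (∣ W ∣ * ι (suc n))
    ≤⟨ +-mono-≤ (*-mono-≤-0≤ (0≤∣p∣ (U - 1ℚ)) (0≤p*q (0≤recipOdd (suc n)) (0≤ι (suc n))) ∣U-1∣≤1 (recipOdd*N≤1 n))
                (*-monoˡ-≤-0≤ ½ (nonNegative⁻¹ ½) (∣4O2-3zeta2Partial∣*N≤4 n)) ⟩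
  1ℚ * 1ℚ + ½ * ι 4 ≡⟨⟩
  ι 3 ∎
  where
  open ≤-Reasoning
  U = central (suc n) * lhsPartial (suc n) (suc n)
  W = ι 4 * O2 (suc n) - ι 3 * zeta2Partial (suc n)
  r = recipOdd (suc n)
  ∣[U-1]r∣ : ∣ (U - 1ℚ) * r ∣ ≡ ∣ U - 1ℚ ∣ * r
  ∣[U-1]r∣ = trans (∣p*q∣≡∣p∣*∣q∣ (U - 1ℚ) r) (cong (∣ U - 1ℚ ∣ *_) (0≤p⇒∣p∣≡p (0≤recipOdd (suc n))))
  ∣U-1∣≤1 : ∣ U - 1ℚ ∣ ≤ 1ℚ
  ∣U-1∣≤1 = ∣p-1∣≤1 (0≤p*q (0≤ι (centralBinom (suc n))) (0≤lhsPartial (suc n) (suc n))) (central*lhsPartial≤1 (suc n))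
  distribute : ∀ u r w n → (u * r + ½ * w) * n ≡ u * (r * n) + ½ * (w * n)
  distribute = solve-∀ ℚ-ring

boundary₀*ι[nC] : ∀ N → boundary N 0 * ι (suc N ℕ.* centralBinom (suc N)) ≡ ι 2 * ι (2 ℕ.^ (2 ℕ.* suc N))
boundary₀*ι[nC] N = begin
  ι 2 * (ι n + 1ℚ) * (1ℚ * t) * ι (n ℕ.* C)     ≡⟨ cong (λ x → ι 2 * x * (1ℚ * t) * ι (n ℕ.* C)) (ι-suc n) ⟨
  ι 2 * ι (suc n) * (1ℚ * t) * ι (n ℕ.* C)      ≡⟨ regroup (ι (suc n)) t (ι (n ℕ.* C)) ⟩
  ι 2 * (t * (ι (suc n) * ι (n ℕ.* C)))         ≡⟨ cong (λ x → ι 2 * (t * x)) (ι-homo-* (suc n) (n ℕ.* C)) ⟨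
  ι 2 * (t * ι (suc n ℕ.* (n ℕ.* C)))           ≡⟨ cong (λ x → ι 2 * (t * ι x)) (denom-zero n) ⟨
  ι 2 * (t * ι (denom 0 n))                     ≡⟨ cong (ι 2 *_) (a⁄d*d≡a (2 ℕ.^ (2 ℕ.* n)) (denom 0 n) {{denom≢0 0 N}}) ⟩
  ι 2 * ι (2 ℕ.^ (2 ℕ.* n)) ∎
  where
  open ≡-Reasoning
  n = suc N
  C = centralBinom n
  t = term 0 n
  regroup : ∀ a t x → ι 2 * a * (1ℚ * t) * x ≡ ι 2 * (t * (a * x))
  regroup = solve-∀ ℚ-ring

boundary₀²*[1+N]≤16 : ∀ N → boundary N 0 * boundary N 0 * ι (suc N) ≤ ι 16
boundary₀²*[1+N]≤16 N = *-cancelʳ-≤-pos (ι P) {{ι-pos P {{P≢0}}}} (begin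
  X * X * ι n * ι P                          ≡⟨ cong (X * X * ι n *_) (trans (ι-homo-* n (C ℕ.* C)) (cong (ι n *_) (ι-homo-* C C))) ⟩
  X * X * ι n * (ι n * (ι C * ι C))          ≡⟨ regroup₁ X (ι n) (ι C) ⟩
  (X * (ι n * ι C)) * (X * (ι n * ι C))      ≡⟨ cong (λ x → (X * x) * (X * x)) (ι-homo-* n C) ⟨
  (X * ι (n ℕ.* C)) * (X * ι (n ℕ.* C))      ≡⟨ cong (λ x → x * x) (boundary₀*ι[nC] N) ⟩
  (ι 2 * ι F) * (ι 2 * ι F)                  ≡⟨ regroup₂ (ι F) ⟩
  ι 4 * (ι F * ι F)                          ≡⟨ cong (ι 4 *_) (ι-homo-* F F) ⟨
  ι 4 * ι (F ℕ.* F)                          ≤⟨ *-monoˡ-≤-0≤ (ι 4) (0≤ι 4) (ι-mono-≤ (centralBinom-lowerBound N)) ⟩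
  ι 4 * ι (4 ℕ.* n ℕ.* (C ℕ.* C))            ≡⟨ cong (λ x → ι 4 * ι x) (ℕ.*-assoc 4 n (C ℕ.* C)) ⟩
  ι 4 * ι (4 ℕ.* P)                          ≡⟨ cong (ι 4 *_) (ι-homo-* 4 P) ⟩
  ι 4 * (ι 4 * ι P)                          ≡⟨ *-assoc (ι 4) (ι 4) (ι P) ⟨
  ι 16 * ι P ∎)
  where
  open ≤-Reasoning
  n = suc N
  C = centralBinom n
  F = 2 ℕ.^ (2 ℕ.* n)
  P = n ℕ.* (C ℕ.* C)
  X = boundary N 0
  P≢0 : ℕ.NonZero P
  P≢0 = ℕ.m*n≢0 n (C ℕ.* C) {{_}} {{ℕ.m*n≢0 C C {{centralBinom≢0 n}} {{centralBinom≢0 n}}}}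
  regroup₁ : ∀ x a c → x * x * a * (a * (c * c)) ≡ (x * (a * c)) * (x * (a * c))
  regroup₁ = solve-∀ ℚ-ring
  regroup₂ : ∀ f → (ι 2 * f) * (ι 2 * f) ≡ ι 4 * (f * f)
  regroup₂ = solve-∀ ℚ-ring

-- Convergence

reducedDefect-top-null : Null (λ N → ∣ reducedDefect N N ∣)
reducedDefect-top-null = null-∣∣ (null-from-1/N 3 top)
  where
  top : ∀ N → ∣ reducedDefect N N ∣ * ι N ≤ ι 3
  top zero    = ≤-trans (≤-reflexive (*-zeroʳ ∣ reducedDefect 0 0 ∣)) (0≤ι 3)
  top (suc n) = ∣reducedDefect-top∣*N≤3 n

boundary₀-null : Null (λ N → boundary N 0)
boundary₀-null = null-sqrt (null-from-1/N 16 square)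
  where
  square : ∀ N → ∣ boundary N 0 * boundary N 0 ∣ * ι N ≤ ι 16
  square N = begin
    ∣ X * X ∣ * ι N       ≡⟨ cong (_* ι N) (0≤p⇒∣p∣≡p (0≤p*q (0≤boundary N 0) (0≤boundary N 0))) ⟩
    X * X * ι N           ≤⟨ *-monoˡ-≤-0≤ (X * X) (0≤p*q (0≤boundary N 0) (0≤boundary N 0)) (ι-mono-≤ (ℕ.n≤1+n N)) ⟩
    X * X * ι (suc N)     ≤⟨ boundary₀²*[1+N]≤16 N ⟩
    ι 16 ∎
    where
    open ≤-Reasoning
    X = boundary N 0

defect-null : ∀ m → Null (λ N → defect N m)
defect-null m = null-≤ (suc m) bound
  (null-+ (null-*ˡ (ι 2 * ι m + 1ℚ) reducedDefect-top-null) (null-*ˡ (ι 2) boundary₀-null))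
  where
  bound : ∀ N → N ≥ suc m → ∣ defect N m ∣ ≤ (ι 2 * ι m + 1ℚ) * ∣ reducedDefect N N ∣ + ι 2 * boundary N 0
  bound (suc n) (s≤s m≤n) = ∣defect∣≤ n m (ℕ.m≤n⇒m≤1+n m≤n)

lhsPartial-rhsWith≡defect⁄centralBinom : ∀ m N → (+ 1) ⁄ centralBinom m * defect N m ≡ lhsPartial m N - rhsWith m (zeta2Partial N)
lhsPartial-rhsWith≡defect⁄centralBinom m N = begin
  v * (central m * L - 1ℚ - P)   ≡⟨ regroup v (central m) L P ⟩
  L * (v * central m) - v * (P + 1ℚ) ≡⟨ cong (λ x → L * x - v * (P + 1ℚ)) (a⁄d*d≡a 1 (centralBinom m) {{centralBinom≢0 m}}) ⟩
  L * 1ℚ - v * (P + 1ℚ)          ≡⟨ cong (_- v * (P + 1ℚ)) (*-identityʳ L) ⟩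
  L - v * (P + 1ℚ) ∎
  where
  open ≡-Reasoning
  v = (+ 1) ⁄ centralBinom m
  L = lhsPartial m N
  P = (ι m - ½) * (ι 4 * O2 m - ι 3 * zeta2Partial N)
  regroup : ∀ v c L P → v * (c * L - 1ℚ - P) ≡ L * (v * c) - v * (P + 1ℚ)
  regroup = solve-∀ ℚ-ring

theorem6 : (m : ℕ) → (ε : ℚ) → Positive ε →
    ∃[ N₀ ] ((N : ℕ) → N ≥ N₀ →
      ∣ lhsPartial m N - rhsWith m (zeta2Partial N) ∣ < ε)
theorem6 m = null-≡ (lhsPartial-rhsWith≡defect⁄centralBinom m) (null-*ˡ ((+ 1) ⁄ centralBinom m) (defect-null m))
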